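{- Let $p$ and $q$ be positive integers. For every hypergraph $\mathcal H$ the following statements are equivalent: (i) $\mathcal H$ is hereditary $(p,q)$-Helly; (ii) $\mathcal H$ is $(p,q')$-Helly for every integer $q'\geq q$; (iii) $\mathcal H$ is strong $(p,q)$-Helly; (iv) every partial hypergraph of $\mathcal H$ having exactly $p+1$ edges is strong $(p,q)$-Helly; (v) $\varPhi_q(\mathcal H)$ is hereditary $p$-Helly; (vi) an incidence matrix $M(\mathcal H)$ of $\mathcal H$ contains no incidence matrix of $\mathcal J_{p+1,q,s}$ as a submatrix, for any $s\in\{0,\ldots,q-1\}$; (vii) no partial subhypergraph of $\mathcal H$ is isomorphic to $\mathcal J_{p+1,q,s}$ for any $s\in\{0,\ldots,q-1\}$; (viii) for each $s\in\{0,\ldots,q-1\}$, each subset $U$ of $V(\mathcal H)$ with $|U|=(p+1)(q-s)+s$, and each $p+1$ pairwise disjoint $(q-s)$-subsets $T_1,\ldots,T_{p+1}$ of $U$ such that each of $U-T_1,\ldots,U-T_{p+1}$ is contained in some edge of $\mathcal H$, the basis $\mathcal S=\{T_1\cup Z,\ldots,T_{p+1}\cup Z\}$, where $Z=U-(T_1\cup\cdots\cup T_{p+1})$, satisfies $\mathrm{core}(\mathcal H_{\mathcal S}^\cup)\cap(T_1\cup\cdots\cup T_{p+1})\neq\emptyset$; (ix) for each nontrivial starlike $(p+1,q)$-basis $\mathcal S$ of $\mathcal H$, $\mathrm{core}(\mathcal H^\cup_{\mathcal S})\cap\mathrm{ext}(\mathcal S)\neq\emptyset$; (x) for each starlike $(p+1,q)$-basis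 $\mathcal S$ of $\mathcal H$, either $\mathcal H_{\mathcal S}^\cup$ is empty (has no edges) or $\mathrm{core}(\mathcal H_{\mathcal S}^\cup)\cap\mathrm{ext}(\mathcal S)\neq\emptyset$.
   Context: A hypergraph $\mathcal H$ is a pair $(X,\mathcal E)$ where $X=V(\mathcal H)$ is a finite set and $\mathcal E=E(\mathcal H)$ is a finite family (repetitions allowed) of nonempty subsets of $X$ (the edges) whose union is $X$; a hypergraph is identified with its edge family. The core of a family of sets is the intersection of all its members. A $k$-set is a set of cardinality $k$, a $k^+$-set one of cardinality at least $k$. A family of sets is $(p,q)$-intersecting if every nonempty subfamily of at most $p$ members has core of cardinality at least $q$; a family has the $(p,q)$-Helly property if every nonempty $(p,q)$-intersecting subfamily has core of cardinality at least $q$. A hypergraph is $(p,q)$-Helly if its edge family has the $(p,q)$-Helly property; $p$-Helly means $(p,1)$-Helly. A partial hypergraph of $\mathcal H$ is a hypergraph whose edge family is a subfamily of $E(\mathcal H)$. For $X'\subseteq V(\mathcal H)$, the subhypergraph induced by $X'$ has vertex set $X'$ and edges the nonempty sets $E\cap X'$, $E\in E(\mathcal H)$. A partial subhypergraph is a partial hypergraph of a subhypergraph. $\mathcal H$ is hereditary $(p,q)$-Helly if every subhypergraph of $\mathcal H$ is $(p,q)$-Helly; hereditary $p$-Helly means hereditary $(p,1)$-Helly. $\mathcal H$ is strong $(p,q)$-Helly if for every nonempty $(p,q)$-intersecting partial hypergraph $\mathcal H'$ of $\mathcal H$ there is a nonempty subfamily of at most $p$ edges of $\mathcal H'$ whose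 core equals $\mathrm{core}(\mathcal H')$. For a set $S$, $\varphi_q(S)$ is the set of $q$-subsets of $S$. $\varPhi_q(\mathcal H)$ is the hypergraph whose vertices are the $q$-subsets of $V(\mathcal H)$ contained in some edge of $\mathcal H$ and whose edges are the sets $\varphi_q(E)$ for the edges $E$ of $\mathcal H$ with $|E|\ge q$. An incidence matrix of $\mathcal H$ is a $(0,1)$-matrix with one row per edge and one column per vertex, with a $1$ exactly when the edge contains the vertex. For $s\in\{0,\ldots,q-1\}$, $\mathcal J_{p+1,q,s}$ is the hypergraph (unique up to isomorphism) with $(p+1)(q-s)+s$ vertices and $p+1$ edges $V-T_1,\ldots,V-T_{p+1}$, where $V$ is its vertex set and $T_1,\ldots,T_{p+1}$ are pairwise disjoint $(q-s)$-subsets of $V$. A $(p+1,q)$-basis of $\mathcal H$ is a family $\mathcal S$ of $p+1$ pairwise different $q$-subsets of $V(\mathcal H)$; its support sets are the unions of all but exactly one member of $\mathcal S$; $\mathcal H_{\mathcal S}^\cup$ is the partial hypergraph of $\mathcal H$ formed by the edges containing some support set of $\mathcal S$. $\mathcal S$ is nontrivial if every support set is contained in some edge of $\mathcal H$. $\mathcal S$ is starlike if every vertex belonging to at least two members of $\mathcal S$ belongs to $\mathrm{core}(\mathcal S)$; $\mathrm{ext}(\mathcal S)$ is the set of vertices belonging to some member of $\mathcal S$ but not to $\mathrm{core}(\mathcal S)$. -}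

module Defs where

open import Data.Nat as ℕ using (ℕ; zero; suc; _+_; _*_; _∸_; _^_; _≤_; _<_; _≤?_)
open import Data.Bool using (Bool; true; false; _∧_)
open import Data.Fin using (Fin; zero; suc; remQuot)
open import Data.Fin.Properties using (any?) renaming (_≟_ to _≟ᶠ_)
open import Data.Fin.Subset
open import Data.Fin.Subset.Properties using (_⊆?_; nonempty?)
open import Data.Vec using (Vec; []; _∷_; tabulate)
open import Data.List using (List; []; _∷_; length; filter; map; lookup; allFin)
open import Data.List.Relation.Binary.Sublist.Propositional using () renaming (_⊆_ to _⊑_)
open import Data.List.Relation.Unary.Any using (Any)
open import Data.Product using (Σ; ∃; ∃-syntax; _×_; _,_; proj₁; proj₂)
open import Data.Sum using (_⊎_)
open import Relation.Nullary using (¬_; Dec; yes; no; ¬?; _×-dec_)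
open import Relation.Nullary.Decidable using (⌊_⌋)
open import Relation.Binary.PropositionalEquality using (_≡_; _≢_)
open import Function.Definitions using (Injective)

-- A family (repetitions allowed) is a list of subsets; a subfamily is a
-- sublist (this respects multiplicities).  A hypergraph is a family of
-- nonempty subsets; its vertex set is the union of its edges.

Family : ℕ → Set
Family n = List (Subset n)

module _ {n : ℕ} where

  core : Family n → Subset n
  core = ⋂

  vertices : Family n → Subset n
  vertices = ⋃

  IsHypergraph : Family n → Set
  IsHypergraph F = Data.List.Relation.Unary.All.All Nonempty F
    where import Data.List.Relation.Unary.All

  Intersecting : ℕ → ℕ → Family n → Set
  Intersecting p q F =
    ∀ (G : Family n) → G ⊑ F → G ≢ [] → length G ≤ p → q ≤ ∣ core G ∣

  Helly : ℕ → ℕ → Family n → Set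
  Helly p q F =
    ∀ (G : Family n) → G ⊑ F → G ≢ [] → Intersecting p q G → q ≤ ∣ core G ∣

  induced : Family n → Subset n → Family n
  induced F X = filter nonempty? (map (_∩ X) F)

  HereditaryHelly : ℕ → ℕ → Family n → Set
  HereditaryHelly p q F = ∀ (X : Subset n) → X ⊆ vertices F → Helly p q (induced F X)

  StrongHelly : ℕ → ℕ → Family n → Set
  StrongHelly p q F =
    ∀ (G : Family n) → G ⊑ F → G ≢ [] → Intersecting p q G →
      Σ (Family n) λ K → K ⊑ G × K ≢ [] × length K ≤ p × core K ≡ core G

-- Φ_q.  The q-subsets of Fin n are encoded as elements of Fin (2 ^ n)
-- via the bijection decode : Fin (2 ^ n) → Subset n (binary digits).

decode : ∀ n → Fin (2 ^ n) → Subset n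
decode zero    _ = []
decode (suc n) i with remQuot {2} (2 ^ n) i
... | zero     , j = outside ∷ decode n j
... | suc zero , j = inside  ∷ decode n j

module _ {n : ℕ} where

  φ : ℕ → Subset n → Subset (2 ^ n)
  φ q E = tabulate λ i →
    ⌊ (decode n i ⊆? E) ×-dec (∣ decode n i ∣ ℕ.≟ q) ⌋

  Φ : ℕ → Family n → Family (2 ^ n)
  Φ q F = map (φ q) (filter (λ E → q ≤? ∣ E ∣) F)

-- The hypergraph J_{p+1,q,s}, with t = q - s.  Its vertex set is indexed by
-- (Fin (p+1) × Fin t) ⊎ Fin s : the component inj₁ (i , a) is the a-th
-- element of T_i, the component inj₂ z the z-th element of the remaining
-- s vertices.  Edge i is V - T_i.

JVertex : ℕ → ℕ → ℕ → Set
JVertex p t s = (Fin (suc p) × Fin t) ⊎ Fin s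

Jinc : ∀ {p t s} → Fin (suc p) → JVertex p t s → Bool
Jinc i (Data.Sum.inj₁ (i′ , _)) = Data.Bool.not ⌊ i ≟ᶠ i′ ⌋
Jinc i (Data.Sum.inj₂ _)        = true

module _ {n : ℕ} where

  -- the incidence matrix of H (rows = positions of edges in the list,
  -- columns = vertices of V(H)) contains an incidence matrix of
  -- J_{p+1,q,s} as a submatrix (up to reordering rows/columns of J's matrix)
  ContainsJMatrix : ℕ → ℕ → ℕ → Family n → Set
  ContainsJMatrix p q s F =
    Σ (Fin (suc p) → Fin (length F)) λ r →
    Σ (JVertex p (q ∸ s) s → Fin n) λ c →
      Injective _≡_ _≡_ r × Injective _≡_ _≡_ c ×
      (∀ j → c j ∈ vertices F) ×
      (∀ i j → Data.Vec.lookup (lookup F (r i)) (c j) ≡ Jinc i j)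

  IsoJ : ℕ → ℕ → ℕ → Family n → Set
  IsoJ p q s F =
    length F ≡ suc p ×
    Σ (Fin (suc p) → Fin (length F)) λ σ →
    Σ (JVertex p (q ∸ s) s → Fin n) λ c →
      Injective _≡_ _≡_ σ × Injective _≡_ _≡_ c ×
      (∀ v → v ∈ vertices F → ∃[ j ] c j ≡ v) ×
      (∀ i j → Data.Vec.lookup (lookup F (σ i)) (c j) ≡ Jinc i j)

-- Bases.  A (p+1,q)-basis is given as an injective (pairwise different)
-- indexing S : Fin (p+1) → Subset n of q-subsets of V(H).

module _ {n : ℕ} where

  supportSet : ∀ {p} → (Fin (suc p) → Subset n) → Fin (suc p) → Subset n
  supportSet S k = ⋃ (map S (filter (λ i → ¬? (i ≟ᶠ k)) (allFin _)))

  IsBasis : ∀ p q → Family n → (Fin (suc p) → Subset n) → Set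
  IsBasis p q F S = Injective _≡_ _≡_ S × (∀ i → S i ⊆ vertices F × ∣ S i ∣ ≡ q)

  Nontrivial : ∀ {p} → Family n → (Fin (suc p) → Subset n) → Set
  Nontrivial F S = ∀ k → Any (supportSet S k ⊆_) F

  coreB : ∀ {p} → (Fin (suc p) → Subset n) → Subset n
  coreB S = ⋂ (map S (allFin _))

  Starlike : ∀ {p} → (Fin (suc p) → Subset n) → Set
  Starlike S = ∀ v i j → i ≢ j → v ∈ S i → v ∈ S j → v ∈ coreB S

  ext : ∀ {p} → (Fin (suc p) → Subset n) → Subset n
  ext S = ⋃ (map S (allFin _)) ─ coreB S

  HS∪ : ∀ {p} → Family n → (Fin (suc p) → Subset n) → Family n
  HS∪ F S = filter (λ E → any? (λ k → supportSet S k ⊆? E)) F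

module Conditions (p q : ℕ) {n : ℕ} (F : Family n) where

  cond-i : Set
  cond-i = HereditaryHelly p q F

  cond-ii : Set
  cond-ii = ∀ (q′ : ℕ) → q ≤ q′ → Helly p q′ F

  cond-iii : Set
  cond-iii = StrongHelly p q F

  cond-iv : Set
  cond-iv = ∀ (G : Family n) → G ⊑ F → length G ≡ suc p → StrongHelly p q G

  cond-v : Set
  cond-v = HereditaryHelly p 1 (Φ q F)

  cond-vi : Set
  cond-vi = ∀ (s : ℕ) → s < q → ¬ ContainsJMatrix p q s F

  -- partial subhypergraph: a subfamily G of the subhypergraph induced by X
  cond-vii : Set
  cond-vii = ∀ (s : ℕ) → s < q →
    ¬ (Σ (Subset n) λ X → X ⊆ vertices F ×
        Σ (Family n) λ G → G ⊑ induced F X × IsoJ p q s G)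

  cond-viii : Set
  cond-viii = ∀ (s : ℕ) → s < q →
    ∀ (U : Subset n) → U ⊆ vertices F → ∣ U ∣ ≡ suc p * (q ∸ s) + s →
    ∀ (T : Fin (suc p) → Subset n) →
      (∀ i j → i ≢ j → Empty (T i ∩ T j)) →
      (∀ i → ∣ T i ∣ ≡ q ∸ s × T i ⊆ U × Any ((U ─ T i) ⊆_) F) →
      let TT = ⋃ (map T (allFin _))
          Z  = U ─ TT
          S  = λ i → T i ∪ Z
      in Nonempty (core (HS∪ F S) ∩ TT)

  cond-ix : Set
  cond-ix = ∀ (S : Fin (suc p) → Subset n) → IsBasis p q F S →
    Nontrivial F S → Starlike S → Nonempty (core (HS∪ F S) ∩ ext S)

  cond-x : Set
  cond-x = ∀ (S : Fin (suc p) → Subset n) → IsBasis p q F S →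
    Starlike S → HS∪ F S ≡ [] ⊎ Nonempty (core (HS∪ F S) ∩ ext S)

{-# OPTIONS --safe #-}
module Submission where

-- All ten conditions are compared with (vi), the absence of a submatrix J_{p+1,q,s}.  Call an
-- obstruction p + 1 edges E_0, …, E_p with sets A_0, …, A_p of at least q vertices such that
-- A_k ⊆ E_j for j ≠ k while A_k ⊈ E_k.  Shrinking a (p,q′)-intersecting family whose core has
-- fewer than q′ vertices (or a family with no p members realising its core) to a critical
-- subfamily yields an obstruction, also after passing to subhypergraphs or to Φ_q; and every
-- obstruction contains a J_{p+1,q,s}: take Z inside the core C of the E_k and T_k inside A_k − C.
-- Conversely a copy of J_{p+1,q,s}, read as A_k = T_k ∪ Z, is itself a (p,q)-intersecting family
-- of p + 1 edges whose core meets the copy in only s < q vertices, and {T_k ∪ Z} is a nontrivial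
-- starlike basis for which E_k ∈ H_S^∪ misses T_k; this refutes every other condition.  Finally
-- (i) gives (viii) and (x) directly: restricted to the union of the basis, the edges of H_S^∪
-- form a (p,q)-intersecting subhypergraph, so their core keeps q vertices there, too many to fit
-- into the core of the basis (for (x)) or into Z (for (viii)).

open import Defs
open import Data.Bool using (Bool; true; false; not; _∧_) renaming (_≟_ to _≟ᵇ_)
import Data.Bool.Properties as BoolP
open import Data.Empty using (⊥-elim)
open import Data.Fin using (Fin; zero; suc; punchIn; inject≤; fromℕ<; combine)
import Data.Fin.Properties as FinP
open import Data.Fin.Subset
open import Data.Fin.Subset.Properties
open import Data.List using (List; []; _∷_; length; filter; map; allFin; lookup)
import Data.List.Properties as ListP
open import Data.List.Membership.Propositional using () renaming (_∈_ to _∈ₗ_)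
import Data.List.Membership.Propositional.Properties as ListMemP
open import Data.List.Relation.Unary.All as All using (All; []; _∷_)
import Data.List.Relation.Unary.All.Properties as AllP
open import Data.List.Relation.Unary.Any as Any using (Any; here; there)
import Data.List.Relation.Unary.Any.Properties as AnyP
open import Data.List.Relation.Binary.Sublist.Propositional as Sublist using ([]; _∷_; _∷ʳ_) renaming (_⊆_ to _⊑_)
import Data.List.Relation.Binary.Sublist.Propositional.Properties as SublistP
open import Data.Nat as ℕ using (ℕ; zero; suc; _+_; _*_; _∸_; _^_; _<_; _≤_; z≤n; s≤s; _≤?_; _<?_)
import Data.Nat.Properties as ℕP
open import Data.Product using (Σ; ∃; _×_; _,_; proj₁; proj₂)
open import Data.Sum using (_⊎_; inj₁; inj₂; [_,_]; [_,_]′)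
open import Data.Sum.Properties using (inj₁-injective; inj₂-injective)
open import Data.Sum.Function.Propositional using (_⊎-↔_)
open import Data.Vec as Vec using ([]; _∷_; here; there; tabulate)
import Data.Vec.Properties as VecP
open import Function using (_∘_; id)
open import Function.Bundles using (_⇔_; mk⇔; Equivalence; _↔_; Inverse; Injection)
open import Function.Properties.Inverse using (↔⇒↣)
open import Function.Construct.Composition using (_↔-∘_)
open import Function.Construct.Identity using (↔-id)
open import Function.Definitions using (Injective)
import Function.Properties.Equivalence as ⇔
open import Relation.Nullary using (¬_; Dec; yes; no; ¬?; _×-dec_)
open import Relation.Nullary.Decidable using (⌊_⌋; isYes≗does; dec-true; dec-false; toSum)
open import Relation.Binary.PropositionalEquality using (_≡_; _≢_; ≢-sym; refl; sym; trans; cong; cong₂; subst; module ≡-Reasoning)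

-- Subsets of Fin n

⌊⌋≡true⇒ : ∀ {P : Set} (P? : Dec P) → ⌊ P? ⌋ ≡ true → P
⌊⌋≡true⇒ (yes p) _ = p

⌊⌋≡true⇐ : ∀ {P : Set} (P? : Dec P) → P → ⌊ P? ⌋ ≡ true
⌊⌋≡true⇐ P? p = trans (isYes≗does P?) (dec-true P? p)

lookup≡true⇒∈ : ∀ {n} (S : Subset n) x → Vec.lookup S x ≡ true → x ∈ S
lookup≡true⇒∈ S x = VecP.lookup⇒[]= x S

∈⇒lookup≡true : ∀ {n} {S : Subset n} {x} → x ∈ S → Vec.lookup S x ≡ true
∈⇒lookup≡true = VecP.[]=⇒lookup

∉⇒lookup≡false : ∀ {n} (S : Subset n) x → x ∉ S → Vec.lookup S x ≡ false
∉⇒lookup≡false S x x∉S with Vec.lookup S x in eq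
... | true  = ⊥-elim (x∉S (lookup≡true⇒∈ S x eq))
... | false = refl

lookup-∩ : ∀ {n} (A B : Subset n) x → x ∈ B → Vec.lookup (A ∩ B) x ≡ Vec.lookup A x
lookup-∩ A B x x∈B = begin
  Vec.lookup (A ∩ B) x                ≡⟨ VecP.lookup-zipWith _∧_ x A B ⟩
  Vec.lookup A x ∧ Vec.lookup B x     ≡⟨ cong (Vec.lookup A x ∧_) (∈⇒lookup≡true x∈B) ⟩
  Vec.lookup A x ∧ true               ≡⟨ BoolP.∧-identityʳ _ ⟩
  Vec.lookup A x                      ∎
  where open ≡-Reasoning

↔-injective : ∀ {A B : Set} (e : A ↔ B) → Injective _≡_ _≡_ (Inverse.to e)
↔-injective e = Injection.injective (↔⇒↣ e)

≤1⇒Fin-irrelevant : ∀ {m} → m ≤ 1 → (a b : Fin m) → a ≡ b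
≤1⇒Fin-irrelevant (s≤s z≤n) zero zero = refl

module _ {n : ℕ} where

  ∈tabulate⁺ : ∀ {f : Fin n → Bool} {x} → f x ≡ true → x ∈ tabulate f
  ∈tabulate⁺ {f} {x} fx = lookup≡true⇒∈ (tabulate f) x (trans (VecP.lookup∘tabulate f x) fx)

  ∈tabulate⁻ : ∀ {f : Fin n → Bool} {x} → x ∈ tabulate f → f x ≡ true
  ∈tabulate⁻ {f} {x} x∈ = trans (sym (VecP.lookup∘tabulate f x)) (∈⇒lookup≡true x∈)

  ∈⋂⁺ : ∀ {x} (L : List (Subset n)) → (∀ {E} → E ∈ₗ L → x ∈ E) → x ∈ ⋂ L
  ∈⋂⁺ []      h = ∈⊤
  ∈⋂⁺ (E ∷ L) h = x∈p∩q⁺ (h (here refl) , ∈⋂⁺ L (h ∘ there))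

  ∈⋂⁻ : ∀ {x} (L : List (Subset n)) → x ∈ ⋂ L → ∀ {E} → E ∈ₗ L → x ∈ E
  ∈⋂⁻ (E ∷ L) x∈ (here refl) = proj₁ (x∈p∩q⁻ E (⋂ L) x∈)
  ∈⋂⁻ (E ∷ L) x∈ (there E∈) = ∈⋂⁻ L (proj₂ (x∈p∩q⁻ E (⋂ L) x∈)) E∈

  ∈⋃⁺ : ∀ {x} (L : List (Subset n)) {E} → E ∈ₗ L → x ∈ E → x ∈ ⋃ L
  ∈⋃⁺ (E ∷ L) (here refl) x∈E = x∈p∪q⁺ (inj₁ x∈E)
  ∈⋃⁺ (E ∷ L) (there E∈)  x∈E = x∈p∪q⁺ (inj₂ (∈⋃⁺ L E∈ x∈E))

  ∈⋃⁻ : ∀ {x} (L : List (Subset n)) → x ∈ ⋃ L → ∃ λ E → E ∈ₗ L × x ∈ E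
  ∈⋃⁻ []      x∈ = ⊥-elim (∉⊥ x∈)
  ∈⋃⁻ (E ∷ L) x∈ with x∈p∪q⁻ E (⋃ L) x∈
  ... | inj₁ x∈E = E , here refl , x∈E
  ... | inj₂ x∈⋃ with ∈⋃⁻ L x∈⋃
  ...   | E′ , E′∈ , x∈E′ = E′ , there E′∈ , x∈E′

  module _ {m : ℕ} (T : Fin m → Subset n) where

    ∈⋃-allFin⁺ : ∀ i {x} → x ∈ T i → x ∈ ⋃ (map T (allFin m))
    ∈⋃-allFin⁺ i = ∈⋃⁺ (map T (allFin m)) (ListMemP.∈-map⁺ T (ListMemP.∈-allFin i))

    ∈⋃-allFin⁻ : ∀ {x} → x ∈ ⋃ (map T (allFin m)) → ∃ λ i → x ∈ T i
    ∈⋃-allFin⁻ {x} x∈ with ∈⋃⁻ (map T (allFin m)) x∈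
    ... | _ , E∈ , x∈E with ListMemP.∈-map⁻ T E∈
    ...   | i , _ , refl = i , x∈E

    ∈⋂-allFin⁺ : ∀ {x} → (∀ i → x ∈ T i) → x ∈ ⋂ (map T (allFin m))
    ∈⋂-allFin⁺ {x} x∈T = ∈⋂⁺ (map T (allFin m)) x∈member
      where
      x∈member : ∀ {E} → E ∈ₗ map T (allFin m) → x ∈ E
      x∈member E∈ with ListMemP.∈-map⁻ T E∈
      ... | i , _ , refl = x∈T i

    ∈⋂-allFin⁻ : ∀ {x} → x ∈ ⋂ (map T (allFin m)) → ∀ i → x ∈ T i
    ∈⋂-allFin⁻ x∈ i = ∈⋂⁻ (map T (allFin m)) x∈ (ListMemP.∈-map⁺ T (ListMemP.∈-allFin i))

  image : ∀ {k} → (Fin k → Fin n) → Subset n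
  image g = tabulate λ v → ⌊ FinP.any? (λ a → g a FinP.≟ v) ⌋

  ∈image⁺ : ∀ {k} (g : Fin k → Fin n) a → g a ∈ image g
  ∈image⁺ g a = ∈tabulate⁺ (⌊⌋≡true⇐ (FinP.any? λ b → g b FinP.≟ g a) (a , refl))

  ∈image⁻ : ∀ {k} (g : Fin k → Fin n) {v} → v ∈ image g → ∃ λ a → g a ≡ v
  ∈image⁻ g {v} v∈ = ⌊⌋≡true⇒ (FinP.any? λ a → g a FinP.≟ v) (∈tabulate⁻ v∈)

  x∈p─q⁻ : ∀ (p q : Subset n) {x} → x ∈ p ─ q → x ∈ p × x ∉ q
  x∈p─q⁻ p q x∈ = p─q⊆p p q x∈ , x∉q p q x∈
    where
    x∉q : ∀ {n} (p q : Subset n) {x} → x ∈ p ─ q → x ∉ q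
    x∉q (inside ∷ p) (outside ∷ q) here ()
    x∉q (_ ∷ p) (_ ∷ q) (there x∈) (there x∈q) = x∉q p q x∈ x∈q

  p⊆p─q∪q : ∀ (p q : Subset n) → p ⊆ (p ─ q) ∪ q
  p⊆p─q∪q p q {x} x∈p with x ∈? q
  ... | yes x∈q = x∈p∪q⁺ (inj₂ x∈q)
  ... | no  x∉q = x∈p∪q⁺ (inj₁ (x∈p∧x∉q⇒x∈p─q x∈p x∉q))

  ⊈⇒∃∉ : (A B : Subset n) → ¬ (A ⊆ B) → ∃ λ w → w ∈ A × w ∉ B
  ⊈⇒∃∉ A B A⊈B with FinP.any? (λ w → (w ∈? A) ×-dec ¬? (w ∈? B))
  ... | yes (w , w∈A , w∉B) = w , w∈A , w∉B
  ... | no ∄w = ⊥-elim (A⊈B A⊆B)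
    where
    A⊆B : A ⊆ B
    A⊆B {w} w∈A with w ∈? B
    ... | yes w∈B = w∈B
    ... | no  w∉B = ⊥-elim (∄w (w , w∈A , w∉B))

  ∣∣<⇒⊈ : (A B : Subset n) → ∣ B ∣ < ∣ A ∣ → ¬ (A ⊆ B)
  ∣∣<⇒⊈ A B ∣B∣<∣A∣ A⊆B = ℕP.<⇒≱ ∣B∣<∣A∣ (p⊆q⇒∣p∣≤∣q∣ A⊆B)

  1≤∣∣⇒Nonempty : (A : Subset n) → 1 ≤ ∣ A ∣ → Nonempty A
  1≤∣∣⇒Nonempty A 1≤∣A∣ with ⊈⇒∃∉ A ⊥ (∣∣<⇒⊈ A ⊥ (subst (_< ∣ A ∣) (sym (∣⊥∣≡0 n)) 1≤∣A∣))
  ... | w , w∈A , _ = w , w∈A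

  ∪-least : ∀ {A B X : Subset n} → A ⊆ X → B ⊆ X → A ∪ B ⊆ X
  ∪-least {A} {B} A⊆X B⊆X x∈ = [ A⊆X , B⊆X ] (x∈p∪q⁻ A B x∈)

  ⊆∧∣∣≤⇒≡ : ∀ {A B : Subset n} → A ⊆ B → ∣ B ∣ ≤ ∣ A ∣ → A ≡ B
  ⊆∧∣∣≤⇒≡ {A} {B} A⊆B ∣B∣≤∣A∣ = ⊆-antisym A⊆B B⊆A
    where
    B⊆A : B ⊆ A
    B⊆A with B ⊆? A
    ... | yes B⊆A = B⊆A
    ... | no  B⊈A = let (w , w∈B , w∉A) = ⊈⇒∃∉ B A B⊈A in
                    ⊥-elim (ℕP.<⇒≱ (p⊂q⇒∣p∣<∣q∣ (A⊆B , w , w∈B , w∉A)) ∣B∣≤∣A∣)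

∣p∪q∣+∣p∩q∣≡∣p∣+∣q∣ : ∀ {n} (p q : Subset n) → ∣ p ∪ q ∣ + ∣ p ∩ q ∣ ≡ ∣ p ∣ + ∣ q ∣
∣p∪q∣+∣p∩q∣≡∣p∣+∣q∣ [] [] = refl
∣p∪q∣+∣p∩q∣≡∣p∣+∣q∣ (inside  ∷ p) (inside  ∷ q) =
  cong suc (trans (ℕP.+-suc _ _) (trans (cong suc (∣p∪q∣+∣p∩q∣≡∣p∣+∣q∣ p q)) (sym (ℕP.+-suc _ _))))
∣p∪q∣+∣p∩q∣≡∣p∣+∣q∣ (inside  ∷ p) (outside ∷ q) = cong suc (∣p∪q∣+∣p∩q∣≡∣p∣+∣q∣ p q)
∣p∪q∣+∣p∩q∣≡∣p∣+∣q∣ (outside ∷ p) (inside  ∷ q) = trans (cong suc (∣p∪q∣+∣p∩q∣≡∣p∣+∣q∣ p q)) (sym (ℕP.+-suc _ _))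
∣p∪q∣+∣p∩q∣≡∣p∣+∣q∣ (outside ∷ p) (outside ∷ q) = ∣p∪q∣+∣p∩q∣≡∣p∣+∣q∣ p q

∣p∪q∣≤∣p∣+∣q∣ : ∀ {n} (p q : Subset n) → ∣ p ∪ q ∣ ≤ ∣ p ∣ + ∣ q ∣
∣p∪q∣≤∣p∣+∣q∣ p q = ℕP.≤-trans (ℕP.m≤m+n _ _) (ℕP.≤-reflexive (∣p∪q∣+∣p∩q∣≡∣p∣+∣q∣ p q))

∣p∣≤∣p─q∣+∣q∣ : ∀ {n} (p q : Subset n) → ∣ p ∣ ≤ ∣ p ─ q ∣ + ∣ q ∣
∣p∣≤∣p─q∣+∣q∣ p q = ℕP.≤-trans (p⊆q⇒∣p∣≤∣q∣ (p⊆p─q∪q p q)) (∣p∪q∣≤∣p∣+∣q∣ (p ─ q) q)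

∣p∪q∣≡∣p∣+∣q∣ : ∀ {n} (p q : Subset n) → Empty (p ∩ q) → ∣ p ∪ q ∣ ≡ ∣ p ∣ + ∣ q ∣
∣p∪q∣≡∣p∣+∣q∣ {n} p q disjoint = begin
  ∣ p ∪ q ∣                ≡⟨ ℕP.+-identityʳ _ ⟨
  ∣ p ∪ q ∣ + 0            ≡⟨ cong (∣ p ∪ q ∣ +_) ∣p∩q∣≡0 ⟨
  ∣ p ∪ q ∣ + ∣ p ∩ q ∣    ≡⟨ ∣p∪q∣+∣p∩q∣≡∣p∣+∣q∣ p q ⟩
  ∣ p ∣ + ∣ q ∣            ∎
  where
  open ≡-Reasoning
  ∣p∩q∣≡0 = trans (cong ∣_∣ (Empty-unique disjoint)) (∣⊥∣≡0 n)

∣p─q∣+∣q∣≡∣p∣ : ∀ {n} (p q : Subset n) → q ⊆ p → ∣ p ─ q ∣ + ∣ q ∣ ≡ ∣ p ∣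
∣p─q∣+∣q∣≡∣p∣ p q q⊆p = trans (sym (∣p∪q∣≡∣p∣+∣q∣ (p ─ q) q disjoint))
  (cong ∣_∣ (⊆-antisym (∪-least (p─q⊆p p q) q⊆p) (p⊆p─q∪q p q)))
  where
  disjoint : Empty ((p ─ q) ∩ q)
  disjoint (x , x∈) = let (x∈p─q , x∈q) = x∈p∩q⁻ (p ─ q) q x∈ in proj₂ (x∈p─q⁻ p q x∈p─q) x∈q

∣⋃∣≤length*bound : ∀ {n} (L : List (Subset n)) b → All (λ S → ∣ S ∣ ≤ b) L → ∣ ⋃ L ∣ ≤ length L * b
∣⋃∣≤length*bound {n} []      b []           = ℕP.≤-reflexive (∣⊥∣≡0 n)
∣⋃∣≤length*bound     (S ∷ L) b (∣S∣≤ ∷ ∣L∣≤) =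
  ℕP.≤-trans (∣p∪q∣≤∣p∣+∣q∣ S (⋃ L)) (ℕP.+-mono-≤ ∣S∣≤ (∣⋃∣≤length*bound L b ∣L∣≤))

record Enumeration {n} (S : Subset n) : Set where
  field
    element   : Fin ∣ S ∣ → Fin n
    injective : Injective _≡_ _≡_ element
    element∈  : ∀ a → element a ∈ S
    onto      : ∀ {v} → v ∈ S → ∃ λ a → element a ≡ v

enumerate : ∀ {n} (S : Subset n) → Enumeration S
enumerate [] = record { element = λ () ; injective = λ {} ; element∈ = λ () ; onto = λ () }
enumerate (outside ∷ S) = record
  { element   = suc ∘ element
  ; injective = λ eq → injective (FinP.suc-injective eq)
  ; element∈  = λ a → there (element∈ a)
  ; onto      = λ { (there v∈) → let (a , eq) = onto v∈ in a , cong suc eq } }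
  where open Enumeration (enumerate S)
enumerate (inside ∷ S) = record
  { element   = λ { zero → zero ; (suc a) → suc (element a) }
  ; injective = λ { {zero} {zero} _ → refl ; {zero} {suc _} () ; {suc _} {zero} ()
                  ; {suc a} {suc b} eq → cong suc (injective (FinP.suc-injective eq)) }
  ; element∈  = λ { zero → here ; (suc a) → there (element∈ a) }
  ; onto      = λ { here → zero , refl ; (there v∈) → let (a , eq) = onto v∈ in suc a , cong suc eq } }
  where open Enumeration (enumerate S)

module _ {n : ℕ} where

  injection⇒≤∣∣ : ∀ {k} (S : Subset n) (g : Fin k → Fin n) → Injective _≡_ _≡_ g → (∀ a → g a ∈ S) → k ≤ ∣ S ∣
  injection⇒≤∣∣ S g g-inj g∈S = FinP.injective⇒≤ {f = index} index-inj
    where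
    open Enumeration (enumerate S)
    index = λ a → proj₁ (onto (g∈S a))
    index-inj : Injective _≡_ _≡_ index
    index-inj {a} {b} eq = g-inj (trans (sym (proj₂ (onto (g∈S a)))) (trans (cong element eq) (proj₂ (onto (g∈S b)))))

  surjection⇒∣∣≤ : ∀ {k} (S : Subset n) (g : Fin k → Fin n) → (∀ {v} → v ∈ S → ∃ λ a → g a ≡ v) → ∣ S ∣ ≤ k
  surjection⇒∣∣≤ S g g-onto = FinP.injective⇒≤ {f = index} index-inj
    where
    open Enumeration (enumerate S)
    index = λ b → proj₁ (g-onto (element∈ b))
    index-inj : Injective _≡_ _≡_ index
    index-inj {a} {b} eq = injective (trans (sym (proj₂ (g-onto (element∈ a)))) (trans (cong g eq) (proj₂ (g-onto (element∈ b)))))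

  pick : ∀ {k} (S : Subset n) → k ≤ ∣ S ∣ → Σ (Fin k → Fin n) λ g → Injective _≡_ _≡_ g × (∀ a → g a ∈ S)
  pick S k≤∣S∣ = element ∘ shrink , (λ eq → FinP.inject≤-injective k≤∣S∣ k≤∣S∣ _ _ (injective eq)) , element∈ ∘ shrink
    where
    open Enumeration (enumerate S)
    shrink = λ a → inject≤ a k≤∣S∣

  ∣image∣≡ : ∀ {k} (g : Fin k → Fin n) → Injective _≡_ _≡_ g → ∣ image g ∣ ≡ k
  ∣image∣≡ g g-inj = ℕP.≤-antisym (surjection⇒∣∣≤ (image g) g (∈image⁻ g)) (injection⇒≤∣∣ (image g) g g-inj (∈image⁺ g))

∣⋃∣≡ : ∀ {n m t} (T : Fin m → Subset n) → (∀ i j → i ≢ j → Empty (T i ∩ T j)) → (∀ i → ∣ T i ∣ ≡ t) →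
  ∣ ⋃ (map T (allFin m)) ∣ ≡ m * t
∣⋃∣≡ {n} {m} {t} T disjoint ∣T∣≡t = ℕP.≤-antisym ∣⋃∣≤ ≤∣⋃∣
  where
  ∣⋃∣≤ : ∣ ⋃ (map T (allFin m)) ∣ ≤ m * t
  ∣⋃∣≤ = subst (λ k → ∣ ⋃ (map T (allFin m)) ∣ ≤ k * t)
           (trans (ListP.length-map T (allFin m)) (ListP.length-tabulate {n = m} id))
           (∣⋃∣≤length*bound (map T (allFin m)) t (AllP.map⁺ (AllP.tabulate⁺ (λ i → ℕP.≤-reflexive (∣T∣≡t i)))))
  enumT = λ i → pick (T i) (ℕP.≤-reflexive (sym (∣T∣≡t i)))
  g : Fin m × Fin t → Fin n
  g (i , a) = proj₁ (enumT i) a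
  g∈T : ∀ ia → g ia ∈ T (proj₁ ia)
  g∈T (i , a) = proj₂ (proj₂ (enumT i)) a
  g-inj : Injective _≡_ _≡_ g
  g-inj {i , a} {i′ , a′} eq with i FinP.≟ i′
  ... | yes refl = cong (i ,_) (proj₁ (proj₂ (enumT i)) eq)
  ... | no  i≢i′ = ⊥-elim (disjoint i i′ i≢i′ (g (i , a) , x∈p∩q⁺ (g∈T (i , a) , subst (_∈ T i′) (sym eq) (g∈T (i′ , a′)))))
  ≤∣⋃∣ : m * t ≤ ∣ ⋃ (map T (allFin m)) ∣
  ≤∣⋃∣ = injection⇒≤∣∣ _ (g ∘ Inverse.to FinP.*↔×) (λ eq → ↔-injective FinP.*↔× (g-inj eq))
           (λ b → ∈⋃-allFin⁺ T _ (g∈T (Inverse.to FinP.*↔× b)))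

<⇒∃unhit : ∀ {m k} (g : Fin m → Fin k) → m < k → ∃ λ j → ∀ a → g a ≢ j
<⇒∃unhit {m} {k} g m<k with FinP.any? (λ j → FinP.all? (λ a → ¬? (g a FinP.≟ j)))
... | yes found = found
... | no  ∄j    = ⊥-elim (ℕP.<⇒≱ m<k (subst (_≤ m) (∣⊤∣≡n k) (surjection⇒∣∣≤ ⊤ g hit)))
  where
  hit : ∀ {j} → j ∈ ⊤ → ∃ λ a → g a ≡ j
  hit {j} _ with FinP.any? (λ a → g a FinP.≟ j)
  ... | yes h = h
  ... | no ¬h = ⊥-elim (∄j (j , λ a eq → ¬h (a , eq)))

_≟ˢ_ : ∀ {n} (A B : Subset n) → Dec (A ≡ B)
_≟ˢ_ = VecP.≡-dec _≟ᵇ_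

encode : ∀ n → Subset n → Fin (2 ^ n)
encode zero    []            = zero
encode (suc n) (outside ∷ S) = combine {2} {2 ^ n} zero (encode n S)
encode (suc n) (inside  ∷ S) = combine {2} {2 ^ n} (suc zero) (encode n S)

decode-encode : ∀ n (S : Subset n) → decode n (encode n S) ≡ S
decode-encode zero [] = refl
decode-encode (suc n) (outside ∷ S)
  rewrite FinP.remQuot-combine {2} {2 ^ n} zero (encode n S) = cong (outside ∷_) (decode-encode n S)
decode-encode (suc n) (inside ∷ S)
  rewrite FinP.remQuot-combine {2} {2 ^ n} (suc zero) (encode n S) = cong (inside ∷_) (decode-encode n S)

module _ {n : ℕ} where

  ∈φ⁻ : ∀ q (E : Subset n) {x} → x ∈ φ q E → decode n x ⊆ E × ∣ decode n x ∣ ≡ q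
  ∈φ⁻ q E {x} x∈ = ⌊⌋≡true⇒ ((decode n x ⊆? E) ×-dec (∣ decode n x ∣ ℕ.≟ q)) (∈tabulate⁻ x∈)

  ∈φ⁺ : ∀ q (E : Subset n) {x} → decode n x ⊆ E → ∣ decode n x ∣ ≡ q → x ∈ φ q E
  ∈φ⁺ q E {x} ⊆E ∣∣≡q = ∈tabulate⁺ (⌊⌋≡true⇐ ((decode n x ⊆? E) ×-dec (∣ decode n x ∣ ℕ.≟ q)) (⊆E , ∣∣≡q))

-- Families of sets

∈⇒lookup : ∀ {A : Set} {L : List A} {x} → x ∈ₗ L → ∃ λ i → lookup L i ≡ x
∈⇒lookup x∈ = Any.index x∈ , sym (AnyP.lookup-index x∈)

≢[]⇒1≤length : ∀ {A : Set} (L : List A) → L ≢ [] → 1 ≤ length L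
≢[]⇒1≤length []      L≢[] = ⊥-elim (L≢[] refl)
≢[]⇒1≤length (_ ∷ _) _    = s≤s z≤n

1≤length⇒≢[] : ∀ {A : Set} (L : List A) → 1 ≤ length L → L ≢ []
1≤length⇒≢[] (_ ∷ _) _ ()

∈⇒≢[] : ∀ {A : Set} {L : List A} {x} → x ∈ₗ L → L ≢ []
∈⇒≢[] {L = _ ∷ _} _ ()

∉⇒≡[] : ∀ {A : Set} (L : List A) → (∀ {x} → ¬ x ∈ₗ L) → L ≡ []
∉⇒≡[] []      _ = refl
∉⇒≡[] (E ∷ L) ∉ = ⊥-elim (∉ (here refl))

record Embedding {A B : Set} (K : List A) (L : List B) (f : B → A) : Set where
  field
    pos           : Fin (length K) → Fin (length L)
    pos-injective : Injective _≡_ _≡_ pos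
    lookup-pos    : ∀ a → lookup K a ≡ f (lookup L (pos a))
open Embedding

module _ {A B : Set} {f : B → A} {K : List A} {L : List B} where

  skip : ∀ y → Embedding K L f → Embedding K (y ∷ L) f
  skip y e = record
    { pos = suc ∘ pos e ; pos-injective = λ eq → pos-injective e (FinP.suc-injective eq) ; lookup-pos = lookup-pos e }

  keep : ∀ y → Embedding K L f → Embedding (f y ∷ K) (y ∷ L) f
  keep y e = record
    { pos           = λ { zero → zero ; (suc a) → suc (pos e a) }
    ; pos-injective = λ { {zero} {zero} _ → refl ; {zero} {suc _} () ; {suc _} {zero} ()
                        ; {suc a} {suc b} eq → cong suc (pos-injective e (FinP.suc-injective eq)) }
    ; lookup-pos    = λ { zero → refl ; (suc a) → lookup-pos e a } }

  embedding-map : ∀ {g : B → A} → (∀ y → f y ≡ g y) → Embedding K L f → Embedding K L g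
  embedding-map f≡g e = record
    { pos = pos e ; pos-injective = pos-injective e ; lookup-pos = λ a → trans (lookup-pos e a) (f≡g _) }

empty-embedding : ∀ {A B : Set} {f : B → A} {L : List B} → Embedding [] L f
empty-embedding = record { pos = λ () ; pos-injective = λ {} ; lookup-pos = λ () }

_∘-embedding_ : ∀ {A B C : Set} {K : List A} {L : List B} {M : List C} {f g} →
  Embedding K L f → Embedding L M g → Embedding K M (f ∘ g)
_∘-embedding_ {f = f} e₁ e₂ = record
  { pos           = pos e₂ ∘ pos e₁
  ; pos-injective = λ eq → pos-injective e₁ (pos-injective e₂ eq)
  ; lookup-pos    = λ a → trans (lookup-pos e₁ a) (cong f (lookup-pos e₂ (pos e₁ a))) }

⊑⇒embedding : ∀ {A : Set} {K L : List A} → K ⊑ L → Embedding K L id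
⊑⇒embedding []         = empty-embedding
⊑⇒embedding (y ∷ʳ τ)   = skip y (⊑⇒embedding τ)
⊑⇒embedding (refl ∷ τ) = keep _ (⊑⇒embedding τ)

module _ {n : ℕ} where

  induced-embedding : (F : Family n) (X : Subset n) → Embedding (induced F X) F (_∩ X)
  induced-embedding []      X = empty-embedding
  induced-embedding (E ∷ F) X with nonempty? (E ∩ X)
  ... | no  _ = skip E (induced-embedding F X)
  ... | yes _ = keep E (induced-embedding F X)

  induced-pos-onto : (F : Family n) (X : Subset n) (i : Fin (length F)) → Nonempty (lookup F i ∩ X) →
    ∃ λ a → pos (induced-embedding F X) a ≡ i
  induced-pos-onto (E ∷ F) X zero ne with nonempty? (E ∩ X)
  ... | no ¬ne = ⊥-elim (¬ne ne)
  ... | yes _  = zero , refl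
  induced-pos-onto (E ∷ F) X (suc i) ne with nonempty? (E ∩ X) | induced-pos-onto F X i ne
  ... | no  _ | a , eq = a , cong suc eq
  ... | yes _ | a , eq = suc a , cong suc eq

  Φ-embedding : (q : ℕ) (F : Family n) → Embedding (Φ q F) F (φ q)
  Φ-embedding q []      = empty-embedding
  Φ-embedding q (E ∷ F) with q ℕ.≤ᵇ ∣ E ∣
  ... | false = skip E (Φ-embedding q F)
  ... | true  = keep E (Φ-embedding q F)

  induced-mono : ∀ {K L : Family n} (X : Subset n) → K ⊑ L → induced K X ⊑ induced L X
  induced-mono X τ = SublistP.filter⁺ nonempty? nonempty? (λ { refl ne → ne }) (SublistP.map⁺ (_∩ X) τ)

  ∈induced⁺ : ∀ (F : Family n) (X : Subset n) {E} → E ∈ₗ F → Nonempty (E ∩ X) → E ∩ X ∈ₗ induced F X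
  ∈induced⁺ F X E∈ ne = ListMemP.∈-filter⁺ nonempty? (ListMemP.∈-map⁺ (_∩ X) E∈) ne

  All-induced : ∀ {P Q : Subset n → Set} (F : Family n) (X : Subset n) →
    (∀ {E} → P E → Q (E ∩ X)) → All P F → All Q (induced F X)
  All-induced []      X P⇒Q []         = []
  All-induced (E ∷ F) X P⇒Q (PE ∷ PF) with nonempty? (E ∩ X)
  ... | yes _ = P⇒Q PE ∷ All-induced F X P⇒Q PF
  ... | no  _ = All-induced F X P⇒Q PF

  vertices-induced⊆ : ∀ (F : Family n) (X : Subset n) {G} → G ⊑ induced F X → vertices G ⊆ X
  vertices-induced⊆ F X {G} τ {v} v∈ with ∈⋃⁻ G v∈
  ... | E , E∈G , v∈E with ListMemP.∈-filter⁻ nonempty? {xs = map (_∩ X) F} (SublistP.Any-resp-⊆ τ E∈G)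
  ...   | E∈ , _ with ListMemP.∈-map⁻ (_∩ X) E∈
  ...     | E′ , _ , refl = proj₂ (x∈p∩q⁻ E′ X v∈E)

  ⊆-∈⇒Any : ∀ {X E : Subset n} {F : Family n} → E ∈ₗ F → X ⊆ E → Any (X ⊆_) F
  ⊆-∈⇒Any {X} E∈ X⊆E = Any.map (λ { refl {x} → X⊆E {x} }) E∈

  core-antitone : ∀ {K L : Family n} → K ⊑ L → core L ⊆ core K
  core-antitone {K} {L} τ v∈ = ∈⋂⁺ K (λ E∈ → ∈⋂⁻ L v∈ (SublistP.Any-resp-⊆ τ E∈))

  core⊆ : ∀ {K : Family n} {E} → E ∈ₗ K → core K ⊆ E
  core⊆ {K} E∈ v∈ = ∈⋂⁻ K v∈ E∈

  ⊆core : ∀ {K : Family n} {A} → (∀ {E} → E ∈ₗ K → A ⊆ E) → A ⊆ core K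
  ⊆core {K} A⊆ v∈ = ∈⋂⁺ K (λ E∈ → A⊆ E∈ v∈)

  strongHelly-⊑ : ∀ {p q} {F G : Family n} → StrongHelly p q F → G ⊑ F → StrongHelly p q G
  strongHelly-⊑ strong τ K σ = strong K (Sublist.⊆-trans σ τ)

select : ∀ {A : Set} (G : List A) → Subset (length G) → List A
select []      []            = []
select (x ∷ G) (inside  ∷ M) = x ∷ select G M
select (x ∷ G) (outside ∷ M) = select G M

module _ {A : Set} where

  select-⊑ : ∀ (G : List A) M → select G M ⊑ G
  select-⊑ []      []            = []
  select-⊑ (x ∷ G) (inside  ∷ M) = refl ∷ select-⊑ G M
  select-⊑ (x ∷ G) (outside ∷ M) = x ∷ʳ select-⊑ G M

  length-select : ∀ (G : List A) M → length (select G M) ≡ ∣ M ∣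
  length-select []      []            = refl
  length-select (x ∷ G) (inside  ∷ M) = cong suc (length-select G M)
  length-select (x ∷ G) (outside ∷ M) = length-select G M

  select-⊤ : ∀ (G : List A) → select G ⊤ ≡ G
  select-⊤ []      = refl
  select-⊤ (x ∷ G) = cong (x ∷_) (select-⊤ G)

  All-select : ∀ {P : A → Set} (G : List A) M → (∀ i → i ∈ M → P (lookup G i)) → All P (select G M)
  All-select []      []            h = []
  All-select (x ∷ G) (inside  ∷ M) h = h zero here ∷ All-select G M (λ i i∈ → h (suc i) (there i∈))
  All-select (x ∷ G) (outside ∷ M) h = All-select G M (λ i i∈ → h (suc i) (there i∈))

  lookup∈select : ∀ (G : List A) M i → i ∈ M → lookup G i ∈ₗ select G M
  lookup∈select (x ∷ G) (inside  ∷ M) zero    here       = here refl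
  lookup∈select (x ∷ G) (inside  ∷ M) (suc i) (there i∈) = there (lookup∈select G M i i∈)
  lookup∈select (x ∷ G) (outside ∷ M) (suc i) (there i∈) = lookup∈select G M i i∈

  select-pos-onto : ∀ (G : List A) M i → i ∈ M → ∃ λ b → pos (⊑⇒embedding (select-⊑ G M)) b ≡ i
  select-pos-onto (x ∷ G) (inside  ∷ M) zero    here       = zero , refl
  select-pos-onto (x ∷ G) (inside  ∷ M) (suc i) (there i∈) = let (b , eq) = select-pos-onto G M i i∈ in suc b , cong suc eq
  select-pos-onto (x ∷ G) (outside ∷ M) (suc i) (there i∈) = let (b , eq) = select-pos-onto G M i i∈ in b , cong suc eq

module _ {n : ℕ} where

  ∈core-select⁺ : ∀ (G : Family n) M {v} → (∀ i → i ∈ M → v ∈ lookup G i) → v ∈ core (select G M)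
  ∈core-select⁺ G M h = ∈⋂⁺ (select G M) (All.lookup (All-select G M h))

  ∈core-select⁻ : ∀ (G : Family n) M {v} → v ∈ core (select G M) → ∀ i → i ∈ M → v ∈ lookup G i
  ∈core-select⁻ G M v∈ i i∈ = ∈⋂⁻ (select G M) v∈ (lookup∈select G M i i∈)

  core-select-antitone : (G : Family n) (M : Subset (length G)) (i : Fin (length G)) → core (select G M) ⊆ core (select G (M - i))
  core-select-antitone G M i v∈ = ∈core-select⁺ G (M - i) (λ j j∈ → ∈core-select⁻ G M v∈ j (p─q⊆p M ⁅ i ⁆ j∈))

module _ {n : ℕ} where

  module _ {p : ℕ} (S : Fin (suc p) → Subset n) where

    ∈supportSet⁺ : ∀ k j → j ≢ k → S j ⊆ supportSet S k
    ∈supportSet⁺ k j j≢k = ∈⋃⁺ (map S (filter (λ i → ¬? (i FinP.≟ k)) (allFin _)))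
      (ListMemP.∈-map⁺ S (ListMemP.∈-filter⁺ (λ i → ¬? (i FinP.≟ k)) (ListMemP.∈-allFin j) j≢k))

    supportSet-least : ∀ k {E} → (∀ j → j ≢ k → S j ⊆ E) → supportSet S k ⊆ E
    supportSet-least k {E} S⊆E y∈ with ∈⋃⁻ (map S (filter (λ i → ¬? (i FinP.≟ k)) (allFin _))) y∈
    ... | _ , S∈ , y∈S with ListMemP.∈-map⁻ S S∈
    ...   | j , j∈ , refl = S⊆E j (proj₂ (ListMemP.∈-filter⁻ (λ i → ¬? (i FinP.≟ k)) {xs = allFin _} j∈)) y∈S

    private
      supported? : (E : Subset n) → Dec (∃ λ k → supportSet S k ⊆ E)
      supported? E = FinP.any? (λ k → supportSet S k ⊆? E)

    HS∪-⊑ : (F : Family n) → HS∪ F S ⊑ F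
    HS∪-⊑ F = SublistP.filter-⊆ supported? F

    All-HS∪ : (F : Family n) → All (λ E → ∃ λ k → supportSet S k ⊆ E) (HS∪ F S)
    All-HS∪ F = AllP.all-filter supported? F

    supported⇒∈HS∪ : (F : Family n) → ∀ k → Any (supportSet S k ⊆_) F → ∃ λ E → E ∈ₗ HS∪ F S
    supported⇒∈HS∪ F k supported = _ ,
      ListMemP.∈-filter⁺ supported? (ListMemP.∈-lookup {xs = F} (Any.index supported)) (k , AnyP.lookup-index supported)

    core-HS∪⊆ : (F : Family n) {E : Subset n} → E ∈ₗ F → ∀ k → supportSet S k ⊆ E → core (HS∪ F S) ⊆ E
    core-HS∪⊆ F E∈ k ⊆E = core⊆ (ListMemP.∈-filter⁺ supported? E∈ (k , ⊆E))

  module _ {m : ℕ} (f : Fin m → Subset n) where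

    among : Family n → Family n
    among = filter (λ E → FinP.any? (λ k → E ≟ˢ f k))

    among-⊑ : (L : Family n) → among L ⊑ L
    among-⊑ = SublistP.filter-⊆ (λ E → FinP.any? (λ k → E ≟ˢ f k))

    ∈among⁺ : ∀ {L} k → f k ∈ₗ L → f k ∈ₗ among L
    ∈among⁺ k f∈ = ListMemP.∈-filter⁺ (λ E → FinP.any? (λ k → E ≟ˢ f k)) f∈ (k , refl)

    All-among : (L : Family n) → All (λ E → ∃ λ k → E ≡ f k) (among L)
    All-among = AllP.all-filter (λ E → FinP.any? (λ k → E ≟ˢ f k))

-- Obstructions

module Obstructions (p : ℕ) (1≤p : 1 ≤ p) where

  other : Fin (suc p) → Fin (suc p)
  other k = punchIn k (fromℕ< 1≤p)

  other≢ : ∀ k → other k ≢ k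
  other≢ k = FinP.punchInᵢ≢i k (fromℕ< 1≤p)

  record Obstruction (q : ℕ) {n m : ℕ} (E : Fin m → Subset n) : Set where
    field
      edge      : Fin (suc p) → Fin m
      edge-inj  : Injective _≡_ _≡_ edge
      A         : Fin (suc p) → Subset n
      q≤∣A∣     : ∀ k → q ≤ ∣ A k ∣
      A⊆E       : ∀ k j → j ≢ k → A k ⊆ E (edge j)
      witness   : Fin (suc p) → Fin n
      witness∈A : ∀ k → witness k ∈ A k
      witness∉E : ∀ k → witness k ∉ E (edge k)

  ObstructionFree : ℕ → ∀ {n} → Family n → Set
  ObstructionFree q F = ¬ Obstruction q (lookup F)

  obstruction-mono : ∀ {q q′ n m} {E : Fin m → Subset n} → q ≤ q′ → Obstruction q′ E → Obstruction q E
  obstruction-mono q≤q′ o = record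
    { edge = edge ; edge-inj = edge-inj ; A = A ; q≤∣A∣ = λ k → ℕP.≤-trans q≤q′ (q≤∣A∣ k) ; A⊆E = A⊆E
    ; witness = witness ; witness∈A = witness∈A ; witness∉E = witness∉E }
    where open Obstruction o

  obstruction-restrict : ∀ {q n} {K F : Family n} {X : Subset n} →
    Embedding K F (_∩ X) → Obstruction q (lookup K) → Obstruction q (lookup F)
  obstruction-restrict {K = K} {F} {X} e o = record
    { edge      = pos e ∘ edge
    ; edge-inj  = λ eq → edge-inj (pos-injective e eq)
    ; A         = A
    ; q≤∣A∣     = q≤∣A∣
    ; A⊆E       = λ k j j≢k v∈A → proj₁ (restricted (edge j) (A⊆E k j j≢k v∈A))
    ; witness   = witness
    ; witness∈A = witness∈A
    ; witness∉E = λ k w∈ → witness∉E k (subst (_ ∈_) (sym (lookup-pos e (edge k))) (x∈p∩q⁺ (w∈ , witness∈X k))) }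
    where
    open Obstruction o
    restricted : ∀ i {v} → v ∈ lookup K i → v ∈ lookup F (pos e i) × v ∈ X
    restricted i v∈ = x∈p∩q⁻ _ X (subst (_ ∈_) (lookup-pos e i) v∈)
    witness∈X : ∀ k → witness k ∈ X
    witness∈X k = proj₂ (restricted (edge (other k)) (A⊆E k (other k) (other≢ k) (witness∈A k)))

  obstruction-sublist : ∀ {q n} {K F : Family n} → K ⊑ F → Obstruction q (lookup K) → Obstruction q (lookup F)
  obstruction-sublist τ = obstruction-restrict (embedding-map (λ E → sym (∩-identityʳ E)) (⊑⇒embedding τ))

  module _ {n : ℕ} (G : Family n) (P : Subset (length G) → Set) (P? : ∀ M → Dec (P M)) where

    ShrunkMask : Set
    ShrunkMask = Σ (Subset (length G)) λ M → P M × 1 ≤ ∣ M ∣ ×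
                   (∣ M ∣ ≤ p ⊎ (suc p ≤ ∣ M ∣ × (∀ i → i ∈ M → ¬ P (M - i))))

    shrink : ∀ fuel M → ∣ M ∣ ≤ fuel → P M → 1 ≤ ∣ M ∣ → ShrunkMask
    shrink zero M ∣M∣≤0 _ 1≤∣M∣ = ⊥-elim (ℕP.<⇒≱ 1≤∣M∣ ∣M∣≤0)
    shrink (suc fuel) M ∣M∣≤ PM 1≤∣M∣ with ∣ M ∣ ≤? p
    ... | yes ∣M∣≤p = M , PM , 1≤∣M∣ , inj₁ ∣M∣≤p
    ... | no ∣M∣≰p with FinP.any? (λ i → (i ∈? M) ×-dec P? (M - i))
    ...   | no ∄i = M , PM , 1≤∣M∣ , inj₂ (ℕP.≰⇒> ∣M∣≰p , λ i i∈M P[M-i] → ∄i (i , i∈M , P[M-i]))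
    ...   | yes (i , i∈M , P[M-i]) = shrink fuel (M - i) ∣M-i∣≤fuel P[M-i] 1≤∣M-i∣
      where
      ∣M-i∣≤fuel : ∣ M - i ∣ ≤ fuel
      ∣M-i∣≤fuel = ℕP.≤-pred (ℕP.≤-trans (x∈p⇒∣p-x∣<∣p∣ i∈M) ∣M∣≤)
      ∣M∣≤∣M-i∣+1 : ∣ M ∣ ≤ ∣ M - i ∣ + 1
      ∣M∣≤∣M-i∣+1 = subst (λ k → ∣ M ∣ ≤ ∣ M - i ∣ + k) (∣⁅x⁆∣≡1 i) (∣p∣≤∣p─q∣+∣q∣ M ⁅ i ⁆)
      1≤∣M-i∣ : 1 ≤ ∣ M - i ∣
      1≤∣M-i∣ = ℕP.+-cancelʳ-≤ 1 1 ∣ M - i ∣ (ℕP.≤-trans (ℕP.≤-trans (s≤s 1≤p) (ℕP.≰⇒> ∣M∣≰p)) ∣M∣≤∣M-i∣+1)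

    shrink-all : P ⊤ → G ≢ [] → ShrunkMask
    shrink-all P⊤ G≢[] = shrink (length G) ⊤ (ℕP.≤-reflexive (∣⊤∣≡n _)) P⊤
      (subst (1 ≤_) (sym (∣⊤∣≡n _)) (≢[]⇒1≤length G G≢[]))

  -- Any p + 1 members of M, each paired with the core of the other members, form an obstruction.
  critical⇒obstruction : ∀ {q n} (G : Family n) M → suc p ≤ ∣ M ∣ →
    (∀ i → i ∈ M → q ≤ ∣ core (select G (M - i)) ∣) →
    (∀ i → i ∈ M → ¬ (core (select G (M - i)) ⊆ core (select G M))) →
    Obstruction q (lookup G)
  critical⇒obstruction G M p<∣M∣ large strict = record
    { edge      = edge
    ; edge-inj  = edge-inj
    ; A         = A
    ; q≤∣A∣     = λ k → large (edge k) (edge∈M k)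
    ; A⊆E       = λ k j j≢k v∈ → ∈core-select⁻ G (M - edge k) v∈ (edge j)
                                   (x∈p∧x≢y⇒x∈p-y (edge∈M j) (λ eq → j≢k (edge-inj eq)))
    ; witness   = witness
    ; witness∈A = λ k → proj₁ (proj₂ (gap k))
    ; witness∉E = witness∉E }
    where
    chosen   = pick M p<∣M∣
    edge     = proj₁ chosen
    edge-inj = proj₁ (proj₂ chosen)
    edge∈M   = proj₂ (proj₂ chosen)
    A        = λ k → core (select G (M - edge k))
    gap      = λ k → ⊈⇒∃∉ (A k) (core (select G M)) (strict (edge k) (edge∈M k))
    witness  = λ k → proj₁ (gap k)
    witness∉E : ∀ k → witness k ∉ lookup G (edge k)
    witness∉E k w∈E = proj₂ (proj₂ (gap k)) (∈core-select⁺ G M w∈member)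
      where
      w∈member : ∀ i → i ∈ M → witness k ∈ lookup G i
      w∈member i i∈M with i FinP.≟ edge k
      ... | yes refl = w∈E
      ... | no  i≢   = ∈core-select⁻ G (M - edge k) (proj₁ (proj₂ (gap k))) i (x∈p∧x≢y⇒x∈p-y i∈M i≢)

  module _ {n : ℕ} where

    nonHelly⇒obstruction : ∀ {q} (G : Family n) → G ≢ [] → Intersecting p q G → ∣ core G ∣ < q → Obstruction q (lookup G)
    nonHelly⇒obstruction {q} G G≢[] intersecting ∣core∣<q
      with shrink-all G (λ M → ∣ core (select G M) ∣ < q) (λ M → ∣ core (select G M) ∣ <? q)
             (subst (λ H → ∣ core H ∣ < q) (sym (select-⊤ G)) ∣core∣<q) G≢[]
    ... | M , small , 1≤∣M∣ , inj₁ ∣M∣≤p =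
          ⊥-elim (ℕP.<⇒≱ small (intersecting (select G M) (select-⊑ G M)
            (1≤length⇒≢[] _ (subst (1 ≤_) (sym (length-select G M)) 1≤∣M∣))
            (subst (_≤ p) (sym (length-select G M)) ∣M∣≤p)))
    ... | M , small , _ , inj₂ (p<∣M∣ , critical) = critical⇒obstruction G M p<∣M∣
          (λ i i∈M → ℕP.≮⇒≥ (critical i i∈M))
          (λ i i∈M → ∣∣<⇒⊈ _ _ (ℕP.<-≤-trans small (ℕP.≮⇒≥ (critical i i∈M))))

    module _ {q : ℕ} {F : Family n} (free : ObstructionFree q F) where

      obstructionFree⇒Helly : ∀ q′ → q ≤ q′ → Helly p q′ F
      obstructionFree⇒Helly q′ q≤q′ G τ G≢[] intersecting with q′ ≤? ∣ core G ∣
      ... | yes q′≤ = q′≤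
      ... | no  q′≰ = ⊥-elim (free (obstruction-mono q≤q′
                        (obstruction-sublist τ (nonHelly⇒obstruction G G≢[] intersecting (ℕP.≰⇒> q′≰)))))

      obstructionFree⇒hereditaryHelly : HereditaryHelly p q F
      obstructionFree⇒hereditaryHelly X _ G τ G≢[] intersecting with q ≤? ∣ core G ∣
      ... | yes q≤ = q≤
      ... | no  q≰ = ⊥-elim (free (obstruction-restrict (⊑⇒embedding τ ∘-embedding induced-embedding F X)
                        (nonHelly⇒obstruction G G≢[] intersecting (ℕP.≰⇒> q≰))))

      obstructionFree⇒strongHelly : StrongHelly p q F
      obstructionFree⇒strongHelly G τ G≢[] intersecting
        with shrink-all G (λ M → core (select G M) ≡ core G) (λ M → core (select G M) ≟ˢ core G)
               (cong core (select-⊤ G)) G≢[]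
      ... | M , same , 1≤∣M∣ , inj₁ ∣M∣≤p =
            select G M , select-⊑ G M , 1≤length⇒≢[] _ (subst (1 ≤_) (sym (length-select G M)) 1≤∣M∣) ,
            subst (_≤ p) (sym (length-select G M)) ∣M∣≤p , same
      ... | M , same , _ , inj₂ (p<∣M∣ , critical) =
            ⊥-elim (free (obstruction-sublist τ (critical⇒obstruction G M p<∣M∣ large strict)))
        where
        q≤∣core∣ : q ≤ ∣ core G ∣
        q≤∣core∣ = obstructionFree⇒Helly q ℕP.≤-refl G τ G≢[] intersecting
        large : ∀ i → i ∈ M → q ≤ ∣ core (select G (M - i)) ∣
        large i _ = ℕP.≤-trans q≤∣core∣ (subst (λ C → ∣ C ∣ ≤ ∣ core (select G (M - i)) ∣) same (p⊆q⇒∣p∣≤∣q∣ (core-select-antitone G M i)))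
        strict : ∀ i → i ∈ M → ¬ (core (select G (M - i)) ⊆ core (select G M))
        strict i i∈M ⊆M = critical i i∈M (trans (⊆-antisym ⊆M (core-select-antitone G M i)) same)

  JFree : ℕ → ∀ {n} → Family n → Set
  JFree q F = ∀ s → s < q → ¬ ContainsJMatrix p q s F

  module _ {q : ℕ} (1≤q : 1 ≤ q) {n : ℕ} (F : Family n) (o : Obstruction q (lookup F)) where
    open Obstruction o

    private
      E : Fin (suc p) → Subset n
      E k = lookup F (edge k)

      C : Subset n
      C = ⋂ (map E (allFin (suc p)))

      ∉E : ∀ k {x} → x ∈ A k ─ C → x ∉ E k
      ∉E k {x} x∈ x∈E = proj₂ (x∈p─q⁻ (A k) C x∈) (∈⋂-allFin⁺ E x∈all)
        where
        x∈all : ∀ j → x ∈ E j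
        x∈all j with j FinP.≟ k
        ... | yes refl = x∈E
        ... | no  j≢k  = A⊆E k j j≢k (proj₁ (x∈p─q⁻ (A k) C x∈))

    record JLabelling : Set where
      field
        s           : ℕ
        s<q         : s < q
        t-vertex    : Fin (suc p) → Fin (q ∸ s) → Fin n
        t-injective : ∀ k → Injective _≡_ _≡_ (t-vertex k)
        t-vertex∈   : ∀ k a → t-vertex k a ∈ A k ─ C
        z-vertex    : Fin s → Fin n
        z-injective : Injective _≡_ _≡_ z-vertex
        z-vertex∈C  : ∀ z → z-vertex z ∈ C

    -- If the core C of the p + 1 edges has fewer than q points, Z := C and T_k consists of
    -- q - |C| points of A_k outside C; otherwise Z is any q - 1 points of C and T_k = {witness k}.
    labelling : JLabelling
    labelling with ∣ C ∣ <? q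
    ... | yes ∣C∣<q = record
      { s = ∣ C ∣ ; s<q = ∣C∣<q
      ; t-vertex = λ k → proj₁ (T k) ; t-injective = λ k → proj₁ (proj₂ (T k)) ; t-vertex∈ = λ k → proj₂ (proj₂ (T k))
      ; z-vertex = element ; z-injective = injective ; z-vertex∈C = element∈ }
      where
      open Enumeration (enumerate C)
      q∸∣C∣≤ : ∀ k → q ∸ ∣ C ∣ ≤ ∣ A k ─ C ∣
      q∸∣C∣≤ k = ℕP.m≤n+o⇒m∸n≤o q ∣ C ∣
        (ℕP.≤-trans (q≤∣A∣ k) (ℕP.≤-trans (∣p∣≤∣p─q∣+∣q∣ (A k) C) (ℕP.≤-reflexive (ℕP.+-comm ∣ A k ─ C ∣ ∣ C ∣))))
      T = λ k → pick (A k ─ C) (q∸∣C∣≤ k)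
    ... | no ∣C∣≮q = record
      { s = q ∸ 1 ; s<q = ℕP.∸-monoʳ-< (s≤s z≤n) 1≤q
      ; t-vertex = λ k _ → witness k
      ; t-injective = λ k {a} {b} _ → ≤1⇒Fin-irrelevant (ℕP.≤-reflexive (ℕP.m∸[m∸n]≡n 1≤q)) a b
      ; t-vertex∈ = λ k _ → x∈p∧x∉q⇒x∈p─q (witness∈A k) (λ w∈C → witness∉E k (∈⋂-allFin⁻ E w∈C k))
      ; z-vertex = proj₁ Z ; z-injective = proj₁ (proj₂ Z) ; z-vertex∈C = proj₂ (proj₂ Z) }
      where
      Z = pick C (ℕP.≤-trans (ℕP.m∸n≤m q 1) (ℕP.≮⇒≥ ∣C∣≮q))

    open JLabelling labelling

    private
      vertex : JVertex p (q ∸ s) s → Fin n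
      vertex (inj₁ (k , a)) = t-vertex k a
      vertex (inj₂ z)       = z-vertex z

      t-vertex∈A : ∀ k a → t-vertex k a ∈ A k
      t-vertex∈A k a = proj₁ (x∈p─q⁻ (A k) C (t-vertex∈ k a))

      t-vertex∉C : ∀ k a → t-vertex k a ∉ C
      t-vertex∉C k a = proj₂ (x∈p─q⁻ (A k) C (t-vertex∈ k a))

      incidence : ∀ i j → Vec.lookup (E i) (vertex j) ≡ Jinc i j
      incidence i (inj₁ (k , a)) with i FinP.≟ k
      ... | yes refl = ∉⇒lookup≡false (E i) _ (∉E i (t-vertex∈ i a))
      ... | no  i≢k  = ∈⇒lookup≡true (A⊆E k i i≢k (t-vertex∈A k a))
      incidence i (inj₂ z) = ∈⇒lookup≡true (∈⋂-allFin⁻ E (z-vertex∈C z) i)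

      vertex-injective : Injective _≡_ _≡_ vertex
      vertex-injective {inj₁ (k , a)} {inj₁ (k′ , a′)} eq with k FinP.≟ k′
      ... | yes refl = cong (λ a → inj₁ (k , a)) (t-injective k eq)
      ... | no  k≢k′ = ⊥-elim (∉E k′ (t-vertex∈ k′ a′) (subst (_∈ E k′) eq (A⊆E k k′ (λ e → k≢k′ (sym e)) (t-vertex∈A k a))))
      vertex-injective {inj₁ (k , a)} {inj₂ z} eq = ⊥-elim (t-vertex∉C k a (subst (_∈ C) (sym eq) (z-vertex∈C z)))
      vertex-injective {inj₂ z} {inj₁ (k , a)} eq = ⊥-elim (t-vertex∉C k a (subst (_∈ C) eq (z-vertex∈C z)))
      vertex-injective {inj₂ z} {inj₂ z′} eq = cong inj₂ (z-injective eq)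

      vertex∈E : ∀ j → ∃ λ i → vertex j ∈ E i
      vertex∈E (inj₁ (k , a)) = other k , A⊆E k (other k) (other≢ k) (t-vertex∈A k a)
      vertex∈E (inj₂ z)       = zero , ∈⋂-allFin⁻ E (z-vertex∈C z) zero

    obstruction⇒J : ∃ λ s → s < q × ContainsJMatrix p q s F
    obstruction⇒J = s , s<q , edge , vertex , edge-inj , vertex-injective ,
      (λ j → let (i , v∈E) = vertex∈E j in ∈⋃⁺ F (ListMemP.∈-lookup (edge i)) v∈E) , incidence

  JFree⇒obstructionFree : ∀ {q n} {F : Family n} → 1 ≤ q → JFree q F → ObstructionFree q F
  JFree⇒obstructionFree {F = F} 1≤q free o = let (s , s<q , J) = obstruction⇒J 1≤q F o in free s s<q J

  Φ-obstruction : ∀ {q n} (F : Family n) → Obstruction 1 (lookup (Φ q F)) → Obstruction q (lookup F)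
  Φ-obstruction {q} {n} F o = record
    { edge      = pos e ∘ edge
    ; edge-inj  = λ eq → edge-inj (pos-injective e eq)
    ; A         = λ k → decode n (witness k)
    ; q≤∣A∣     = λ k → ℕP.≤-reflexive (sym (∣A∣≡q k))
    ; A⊆E       = λ k j j≢k → proj₁ (∈φ⁻ q _ (witness∈φ k j j≢k))
    ; witness   = λ k → proj₁ (gap k)
    ; witness∈A = λ k → proj₁ (proj₂ (gap k))
    ; witness∉E = λ k → proj₂ (proj₂ (gap k)) }
    where
    open Obstruction o
    e = Φ-embedding q F
    witness∈φ : ∀ k j → j ≢ k → witness k ∈ φ q (lookup F (pos e (edge j)))
    witness∈φ k j j≢k = subst (witness k ∈_) (lookup-pos e (edge j)) (A⊆E k j j≢k (witness∈A k))
    ∣A∣≡q : ∀ k → ∣ decode n (witness k) ∣ ≡ q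
    ∣A∣≡q k = proj₂ (∈φ⁻ q _ (witness∈φ k (other k) (other≢ k)))
    gap = λ k → ⊈⇒∃∉ (decode n (witness k)) (lookup F (pos e (edge k))) λ ⊆E →
                  witness∉E k (subst (witness k ∈_) (sym (lookup-pos e (edge k))) (∈φ⁺ q _ ⊆E (∣A∣≡q k)))

  Jinc-other : ∀ {t s} (j : JVertex p t s) → ∃ λ i → Jinc i j ≡ true
  Jinc-other (inj₁ (k , _)) = other k , cong not (trans (isYes≗does (other k FinP.≟ k)) (dec-false (other k FinP.≟ k) (other≢ k)))
  Jinc-other (inj₂ _)       = zero , refl

  isoJ⇒J : ∀ {q s n} (F : Family n) (X : Subset n) (G : Family n) → G ⊑ induced F X → IsoJ p q s G →
    ContainsJMatrix p q s F
  isoJ⇒J F X G τ (_ , σ , c , σ-inj , c-inj , _ , inc) = r , c , r-inj , c-inj , c∈V , incidence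
    where
    e = ⊑⇒embedding τ ∘-embedding induced-embedding F X
    r = pos e ∘ σ
    r-inj : Injective _≡_ _≡_ r
    r-inj eq = σ-inj (pos-injective e eq)
    c∈E∩X : ∀ j → ∃ λ i → c j ∈ lookup F (r i) ∩ X
    c∈E∩X j = let (i , Jinc≡true) = Jinc-other j in
      i , subst (c j ∈_) (lookup-pos e (σ i)) (lookup≡true⇒∈ _ (c j) (trans (inc i j) Jinc≡true))
    c∈V : ∀ j → c j ∈ vertices F
    c∈V j = let (i , c∈) = c∈E∩X j in ∈⋃⁺ F (ListMemP.∈-lookup (r i)) (proj₁ (x∈p∩q⁻ _ X c∈))
    incidence : ∀ i j → Vec.lookup (lookup F (r i)) (c j) ≡ Jinc i j
    incidence i j = begin
      Vec.lookup (lookup F (r i)) (c j)      ≡⟨ lookup-∩ (lookup F (r i)) X (c j) (proj₂ (x∈p∩q⁻ _ X (proj₂ (c∈E∩X j)))) ⟨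
      Vec.lookup (lookup F (r i) ∩ X) (c j)  ≡⟨ cong (λ S → Vec.lookup S (c j)) (lookup-pos e (σ i)) ⟨
      Vec.lookup (lookup G (σ i)) (c j)      ≡⟨ inc i j ⟩
      Jinc i j                               ∎
      where open ≡-Reasoning

  CoversAllBut : ∀ {n} → (Fin (suc p) → Subset n) → Subset n → Set
  CoversAllBut A E = ∃ λ k → ∀ j → j ≢ k → A j ⊆ E

  coversAllBut⇒⊆core : ∀ {n} (A : Fin (suc p) → Subset n) (L : Family n) → All (CoversAllBut A) L →
    ∀ K → K ⊑ L → length K ≤ p → ∃ λ j → A j ⊆ core K
  coversAllBut⇒⊆core A L covers K τ ∣K∣≤p = j , ⊆core A⊆
    where
    coversK = SublistP.All-resp-⊆ τ covers
    label = λ a → proj₁ (All.lookup coversK (ListMemP.∈-lookup a))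
    unhit = <⇒∃unhit label (s≤s ∣K∣≤p)
    j = proj₁ unhit
    A⊆ : ∀ {E} → E ∈ₗ K → A j ⊆ E
    A⊆ E∈ with ∈⇒lookup E∈
    ... | a , refl = proj₂ (All.lookup coversK (ListMemP.∈-lookup a)) j (λ eq → proj₂ unhit a (sym eq))

  coversAllBut⇒intersecting : ∀ {q n} (A : Fin (suc p) → Subset n) → (∀ k → q ≤ ∣ A k ∣) →
    (L : Family n) → All (CoversAllBut A) L → Intersecting p q L
  coversAllBut⇒intersecting A q≤∣A∣ L covers K τ _ ∣K∣≤p =
    let (j , A⊆) = coversAllBut⇒⊆core A L covers K τ ∣K∣≤p in ℕP.≤-trans (q≤∣A∣ j) (p⊆q⇒∣p∣≤∣q∣ A⊆)

-- Copies of J_{p+1,q,s}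

module JCopy {p q : ℕ} (1≤p : 1 ≤ p) {n : ℕ} (F : Family n) {s : ℕ} (s<q : s < q) (J : ContainsJMatrix p q s F) where
  open Obstructions p 1≤p using (other; other≢)

  t : ℕ
  t = q ∸ s

  r : Fin (suc p) → Fin (length F)
  r = proj₁ J

  c : JVertex p t s → Fin n
  c = proj₁ (proj₂ J)

  r-inj : Injective _≡_ _≡_ r
  r-inj = proj₁ (proj₂ (proj₂ J))

  c-inj : Injective _≡_ _≡_ c
  c-inj = proj₁ (proj₂ (proj₂ (proj₂ J)))

  c∈V : ∀ j → c j ∈ vertices F
  c∈V = proj₁ (proj₂ (proj₂ (proj₂ (proj₂ J))))

  incidence : ∀ i j → Vec.lookup (lookup F (r i)) (c j) ≡ Jinc i j
  incidence = proj₂ (proj₂ (proj₂ (proj₂ (proj₂ J))))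

  E : Fin (suc p) → Subset n
  E k = lookup F (r k)

  E∈F : ∀ k → E k ∈ₗ F
  E∈F k = ListMemP.∈-lookup (r k)

  tvertex : Fin (suc p) → Fin t → Fin n
  tvertex k a = c (inj₁ (k , a))

  zvertex : Fin s → Fin n
  zvertex z = c (inj₂ z)

  z∈E : ∀ z i → zvertex z ∈ E i
  z∈E z i = lookup≡true⇒∈ (E i) _ (incidence i (inj₂ z))

  t∈E : ∀ k a i → i ≢ k → tvertex k a ∈ E i
  t∈E k a i i≢k = lookup≡true⇒∈ (E i) _
    (trans (incidence i (inj₁ (k , a))) (cong not (trans (isYes≗does (i FinP.≟ k)) (dec-false (i FinP.≟ k) i≢k))))

  t∉E : ∀ k a → tvertex k a ∉ E k
  t∉E k a t∈ with trans (sym (∈⇒lookup≡true t∈))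
                   (trans (incidence k (inj₁ (k , a))) (cong not (trans (isYes≗does (k FinP.≟ k)) (dec-true (k FinP.≟ k) refl))))
  ... | ()

  1≤t : 1 ≤ t
  1≤t = ℕP.m<n⇒0<n∸m s<q

  a₀ : Fin t
  a₀ = fromℕ< 1≤t

  T : Fin (suc p) → Subset n
  T k = image (tvertex k)

  Z : Subset n
  Z = image zvertex

  A : Fin (suc p) → Subset n
  A k = T k ∪ Z

  t∈T : ∀ k a → tvertex k a ∈ T k
  t∈T k = ∈image⁺ (tvertex k)

  t∈A : ∀ k a → tvertex k a ∈ A k
  t∈A k a = x∈p∪q⁺ (inj₁ (t∈T k a))

  ∈T⇒≡ : ∀ {k a i} → tvertex k a ∈ T i → k ≡ i
  ∈T⇒≡ {i = i} t∈ = let (_ , eq) = ∈image⁻ (tvertex i) t∈ in sym (cong proj₁ (inj₁-injective (c-inj eq)))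

  t∉Z : ∀ k a → tvertex k a ∉ Z
  t∉Z k a t∈ with ∈image⁻ zvertex t∈
  ... | _ , eq with c-inj eq
  ...   | ()

  ∈A⇒≡ : ∀ {k a i} → tvertex k a ∈ A i → k ≡ i
  ∈A⇒≡ {k} {a} {i} t∈ with x∈p∪q⁻ (T i) Z t∈
  ... | inj₁ t∈T = ∈T⇒≡ t∈T
  ... | inj₂ t∈Z = ⊥-elim (t∉Z k a t∈Z)

  T∩Z-empty : ∀ k → Empty (T k ∩ Z)
  T∩Z-empty k (x , x∈) with x∈p∩q⁻ (T k) Z x∈
  ... | x∈T , x∈Z with ∈image⁻ (tvertex k) x∈T
  ...   | a , refl = t∉Z k a x∈Z

  T-disjoint : ∀ i j → i ≢ j → Empty (T i ∩ T j)
  T-disjoint i j i≢j (x , x∈) with x∈p∩q⁻ (T i) (T j) x∈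
  ... | x∈Ti , x∈Tj with ∈image⁻ (tvertex i) x∈Ti
  ...   | a , refl = i≢j (∈T⇒≡ x∈Tj)

  ∣T∣≡t : ∀ k → ∣ T k ∣ ≡ t
  ∣T∣≡t k = ∣image∣≡ (tvertex k) (λ eq → cong proj₂ (inj₁-injective (c-inj eq)))

  ∣Z∣≡s : ∣ Z ∣ ≡ s
  ∣Z∣≡s = ∣image∣≡ zvertex (λ eq → inj₂-injective (c-inj eq))

  ∣A∣≡q : ∀ k → ∣ A k ∣ ≡ q
  ∣A∣≡q k = begin
    ∣ T k ∪ Z ∣    ≡⟨ ∣p∪q∣≡∣p∣+∣q∣ (T k) Z (T∩Z-empty k) ⟩
    ∣ T k ∣ + ∣ Z ∣  ≡⟨ cong₂ _+_ (∣T∣≡t k) ∣Z∣≡s ⟩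
    t + s          ≡⟨ ℕP.m∸n+n≡m (ℕP.<⇒≤ s<q) ⟩
    q              ∎
    where open ≡-Reasoning

  q≤∣A∣ : ∀ k → q ≤ ∣ A k ∣
  q≤∣A∣ k = ℕP.≤-reflexive (sym (∣A∣≡q k))

  T⊆E : ∀ k j → j ≢ k → T k ⊆ E j
  T⊆E k j j≢k x∈ = let (a , eq) = ∈image⁻ (tvertex k) x∈ in subst (_∈ E j) eq (t∈E k a j j≢k)

  A⊆E : ∀ k j → j ≢ k → A k ⊆ E j
  A⊆E k j j≢k = ∪-least (T⊆E k j j≢k) λ x∈ → let (z , eq) = ∈image⁻ zvertex x∈ in subst (_∈ E j) eq (z∈E z j)

  vertex↔ : Fin (suc p * t + s) ↔ JVertex p t s
  vertex↔ = (FinP.*↔× ⊎-↔ ↔-id _) ↔-∘ FinP.+↔⊎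

  U : Subset n
  U = image (c ∘ Inverse.to vertex↔)

  ∣U∣≡ : ∣ U ∣ ≡ suc p * t + s
  ∣U∣≡ = ∣image∣≡ (c ∘ Inverse.to vertex↔) (λ eq → ↔-injective vertex↔ (c-inj eq))

  c∈U : ∀ j → c j ∈ U
  c∈U j = subst (λ j → c j ∈ U) (Inverse.strictlyInverseˡ vertex↔ j) (∈image⁺ (c ∘ Inverse.to vertex↔) (Inverse.from vertex↔ j))

  ∈U⇒ : ∀ {x} → x ∈ U → ∃ λ j → c j ≡ x
  ∈U⇒ x∈ = let (a , eq) = ∈image⁻ (c ∘ Inverse.to vertex↔) x∈ in Inverse.to vertex↔ a , eq

  T⊆U : ∀ k → T k ⊆ U
  T⊆U k x∈ = let (a , eq) = ∈image⁻ (tvertex k) x∈ in subst (_∈ U) eq (c∈U _)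

  A⊆U : ∀ k → A k ⊆ U
  A⊆U k = ∪-least (T⊆U k) λ x∈ → let (z , eq) = ∈image⁻ zvertex x∈ in subst (_∈ U) eq (c∈U _)

  U⊆V : U ⊆ vertices F
  U⊆V x∈ = let (j , eq) = ∈U⇒ x∈ in subst (_∈ vertices F) eq (c∈V j)

  E∩U-nonempty : ∀ k → Nonempty (E k ∩ U)
  E∩U-nonempty k = tvertex (other k) a₀ , x∈p∩q⁺ (t∈E (other k) a₀ k (≢-sym (other≢ k)) , c∈U _)

  ∈U∖T⇒∈E : ∀ i {x} → x ∈ U → x ∉ T i → x ∈ E i
  ∈U∖T⇒∈E i x∈U x∉T with ∈U⇒ x∈U
  ... | inj₂ z , refl = z∈E z i
  ... | inj₁ (k , a) , refl with k FinP.≟ i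
  ...   | yes refl = ⊥-elim (x∉T (t∈T k a))
  ...   | no  k≢i  = t∈E k a i (≢-sym k≢i)

  ∈allE⇒∈Z : ∀ {x} → x ∈ U → (∀ k → x ∈ E k) → x ∈ Z
  ∈allE⇒∈Z x∈U x∈E with ∈U⇒ x∈U
  ... | inj₁ (k , a) , refl = ⊥-elim (t∉E k a (x∈E k))
  ... | inj₂ z , refl = ∈image⁺ zvertex z

module _ {p q : ℕ} (1≤p : 1 ≤ p) {n : ℕ} (F : Family n) where
  open Obstructions p 1≤p

  hereditaryHelly⇒JFree : HereditaryHelly p q F → JFree q F
  hereditaryHelly⇒JFree hereditary s s<q J =
    ℕP.<⇒≱ (ℕP.≤-<-trans ∣core∣≤s s<q) (hereditary U U⊆V L (among-⊑ traces (induced F U)) L≢[] intersecting)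
    where
    open JCopy 1≤p F s<q J
    traces = λ k → E k ∩ U
    L = among traces (induced F U)
    trace∈L : ∀ k → E k ∩ U ∈ₗ L
    trace∈L k = ∈among⁺ traces k (∈induced⁺ F U (E∈F k) (E∩U-nonempty k))
    L≢[] = ∈⇒≢[] (trace∈L zero)
    covers : All (CoversAllBut A) L
    covers = All.map (λ { (k , refl) → k , λ j j≢k {_} x∈ → x∈p∩q⁺ (A⊆E j k (≢-sym j≢k) x∈ , A⊆U j x∈) })
                     (All-among traces (induced F U))
    intersecting = coversAllBut⇒intersecting A q≤∣A∣ L covers
    core⊆Z : core L ⊆ Z
    core⊆Z x∈ = ∈allE⇒∈Z (proj₂ (x∈p∩q⁻ _ U (core⊆ (trace∈L zero) x∈)))
                         (λ k → proj₁ (x∈p∩q⁻ _ U (core⊆ (trace∈L k) x∈)))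
    ∣core∣≤s = subst (∣ core L ∣ ≤_) ∣Z∣≡s (p⊆q⇒∣p∣≤∣q∣ core⊆Z)

  -- The edges E_k form a (p, |C| + t)-intersecting family whose core C is too small.
  helly≥⇒JFree : (∀ q′ → q ≤ q′ → Helly p q′ F) → JFree q F
  helly≥⇒JFree helly s s<q J =
    ℕP.<⇒≱ (ℕP.m<m+n ∣ C ∣ 1≤t) (helly q′ q≤q′ L (among-⊑ E F) (∈⇒≢[] (E∈L zero)) intersecting)
    where
    open JCopy 1≤p F s<q J
    L = among E F
    C = core L
    q′ = ∣ C ∣ + t
    E∈L : ∀ k → E k ∈ₗ L
    E∈L k = ∈among⁺ E k (E∈F k)
    covers : All (CoversAllBut A) L
    covers = All.map (λ { (k , refl) → k , λ j j≢k {_} x∈ → A⊆E j k (≢-sym j≢k) x∈ }) (All-among E F)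
    Z⊆C : Z ⊆ C
    Z⊆C = ⊆core λ E∈ → case (All.lookup (All-among E F) E∈)
      where
      case : ∀ {E′} → ∃ (λ k → E′ ≡ E k) → Z ⊆ E′
      case (k , refl) x∈ = let (z , eq) = ∈image⁻ zvertex x∈ in subst (_∈ E k) eq (z∈E z k)
    q≤q′ : q ≤ q′
    q≤q′ = begin
      q            ≡⟨ ℕP.m∸n+n≡m (ℕP.<⇒≤ s<q) ⟨
      t + s        ≡⟨ cong (t +_) ∣Z∣≡s ⟨
      t + ∣ Z ∣     ≤⟨ ℕP.+-monoʳ-≤ t (p⊆q⇒∣p∣≤∣q∣ Z⊆C) ⟩
      t + ∣ C ∣     ≡⟨ ℕP.+-comm t ∣ C ∣ ⟩
      q′           ∎
      where open ℕP.≤-Reasoning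
    q′≤∣A∪C∣ : ∀ j → q′ ≤ ∣ A j ∪ C ∣
    q′≤∣A∪C∣ j = ℕP.+-cancelʳ-≤ s q′ ∣ A j ∪ C ∣ (begin
      ∣ C ∣ + t + s              ≡⟨ ℕP.+-assoc ∣ C ∣ t s ⟩
      ∣ C ∣ + (t + s)            ≡⟨ cong (∣ C ∣ +_) (trans (ℕP.m∸n+n≡m (ℕP.<⇒≤ s<q)) (sym (∣A∣≡q j))) ⟩
      ∣ C ∣ + ∣ A j ∣            ≡⟨ ℕP.+-comm ∣ C ∣ ∣ A j ∣ ⟩
      ∣ A j ∣ + ∣ C ∣            ≡⟨ ∣p∪q∣+∣p∩q∣≡∣p∣+∣q∣ (A j) C ⟨
      ∣ A j ∪ C ∣ + ∣ A j ∩ C ∣  ≤⟨ ℕP.+-monoʳ-≤ ∣ A j ∪ C ∣ (subst (∣ A j ∩ C ∣ ≤_) ∣Z∣≡s (p⊆q⇒∣p∣≤∣q∣ A∩C⊆Z)) ⟩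
      ∣ A j ∪ C ∣ + s            ∎)
      where
      open ℕP.≤-Reasoning
      A∩C⊆Z : A j ∩ C ⊆ Z
      A∩C⊆Z x∈ = let (x∈A , x∈C) = x∈p∩q⁻ (A j) C x∈ in ∈allE⇒∈Z (A⊆U j x∈A) (λ k → core⊆ (E∈L k) x∈C)
    intersecting : Intersecting p q′ L
    intersecting K τ _ ∣K∣≤p = let (j , A⊆) = coversAllBut⇒⊆core A L covers K τ ∣K∣≤p in
      ℕP.≤-trans (q′≤∣A∪C∣ j) (p⊆q⇒∣p∣≤∣q∣ (∪-least A⊆ (core-antitone τ)))

  partialStrongHelly⇒JFree : (∀ G → G ⊑ F → length G ≡ suc p → StrongHelly p q G) → JFree q F
  partialStrongHelly⇒JFree strong s s<q J = t∉E j a₀ (core⊆ (E∈G j) (subst (tvertex j a₀ ∈_) core≡ (A⊆ (t∈A j a₀))))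
    where
    open JCopy 1≤p F s<q J
    G = select F (image r)
    E∈G : ∀ k → E k ∈ₗ G
    E∈G k = lookup∈select F (image r) (r k) (∈image⁺ r k)
    covers : All (CoversAllBut A) G
    covers = All-select F (image r) λ i i∈ → let (k , eq) = ∈image⁻ r i∈ in
      k , λ j j≢k {_} x∈ → subst (λ i → _ ∈ lookup F i) eq (A⊆E j k (≢-sym j≢k) x∈)
    realiser = strong G (select-⊑ F (image r)) (trans (length-select F (image r)) (∣image∣≡ r r-inj))
                 G Sublist.⊆-refl (∈⇒≢[] (E∈G zero)) (coversAllBut⇒intersecting A q≤∣A∣ G covers)
    K = proj₁ realiser
    core≡ : core K ≡ core G
    core≡ = proj₂ (proj₂ (proj₂ (proj₂ realiser)))
    missed = coversAllBut⇒⊆core A G covers K (proj₁ (proj₂ realiser)) (proj₁ (proj₂ (proj₂ (proj₂ realiser))))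
    j = proj₁ missed
    A⊆ = proj₂ missed

  -- In Φ_q(H) the codes of A_0, …, A_p span a subhypergraph whose traces of the edges E_k
  -- form a (p,1)-intersecting family with empty core.
  ΦhereditaryHelly⇒JFree : HereditaryHelly p 1 (Φ q F) → JFree q F
  ΦhereditaryHelly⇒JFree hereditary s s<q J =
    core-empty (1≤∣∣⇒Nonempty (core L) (hereditary 𝒳 𝒳⊆V L (among-⊑ traces (induced (Φ q F) 𝒳)) L≢[] intersecting))
    where
    open JCopy 1≤p F s<q J
    code : Fin (suc p) → Fin (2 ^ n)
    code k = encode n (A k)
    code∈φE : ∀ k j → j ≢ k → code k ∈ φ q (E j)
    code∈φE k j j≢k = ∈φ⁺ q (E j) (subst (_⊆ E j) (sym (decode-encode n (A k))) (A⊆E k j j≢k))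
                                   (trans (cong ∣_∣ (decode-encode n (A k))) (∣A∣≡q k))
    code∉φE : ∀ k → code k ∉ φ q (E k)
    code∉φE k code∈ = t∉E k a₀ (proj₁ (∈φ⁻ q (E k) code∈) (subst (tvertex k a₀ ∈_) (sym (decode-encode n (A k))) (t∈A k a₀)))
    𝒳 : Subset (2 ^ n)
    𝒳 = image code
    φE∈Φ : ∀ j → φ q (E j) ∈ₗ Φ q F
    φE∈Φ j = ListMemP.∈-map⁺ (φ q) (ListMemP.∈-filter⁺ (λ E → q ≤? ∣ E ∣) (E∈F j)
               (ℕP.≤-trans (q≤∣A∣ (other j)) (p⊆q⇒∣p∣≤∣q∣ (A⊆E (other j) j (≢-sym (other≢ j))))))
    𝒳⊆V : 𝒳 ⊆ vertices (Φ q F)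
    𝒳⊆V x∈ with ∈image⁻ code x∈
    ... | k , refl = ∈⋃⁺ (Φ q F) (φE∈Φ (other k)) (code∈φE k (other k) (other≢ k))
    traces = λ k → φ q (E k) ∩ 𝒳
    L = among traces (induced (Φ q F) 𝒳)
    trace∈L : ∀ k → traces k ∈ₗ L
    trace∈L k = ∈among⁺ traces k (∈induced⁺ (Φ q F) 𝒳 (φE∈Φ k)
                  (code (other k) , x∈p∩q⁺ (code∈φE (other k) k (≢-sym (other≢ k)) , ∈image⁺ code (other k))))
    L≢[] = ∈⇒≢[] (trace∈L zero)
    covers : All (CoversAllBut (λ j → ⁅ code j ⁆)) L
    covers = All.map (λ { (k , refl) → k , λ j j≢k {y} y∈ →
               subst (_∈ traces k) (sym (x∈⁅y⁆⇒x≡y (code j) y∈))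
                 (x∈p∩q⁺ (code∈φE j k (≢-sym j≢k) , ∈image⁺ code j)) })
               (All-among traces (induced (Φ q F) 𝒳))
    intersecting = coversAllBut⇒intersecting (λ j → ⁅ code j ⁆) (λ j → ℕP.≤-reflexive (sym (∣⁅x⁆∣≡1 (code j)))) L covers
    core-empty : ¬ Nonempty (core L)
    core-empty (x , x∈core) with ∈image⁻ code (proj₂ (x∈p∩q⁻ _ 𝒳 (core⊆ (trace∈L zero) x∈core)))
    ... | k , refl = code∉φE k (proj₁ (x∈p∩q⁻ _ 𝒳 (core⊆ (trace∈L k) x∈core)))

  JFree⇒partialSubhypergraphs : JFree q F → Conditions.cond-vii p q F
  JFree⇒partialSubhypergraphs free s s<q (X , _ , G , τ , iso) = free s s<q (isoJ⇒J F X G τ iso)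

  partialSubhypergraphs⇒JFree : Conditions.cond-vii p q F → JFree q F
  partialSubhypergraphs⇒JFree noCopy s s<q J =
    noCopy s s<q (U , U⊆V , G , select-⊑ L (image ρ) , ∣G∣≡ , σ , c , σ-inj , c-inj , onto , incidenceG)
    where
    open JCopy 1≤p F s<q J
    L = induced F U
    eL = induced-embedding F U
    hit = λ k → induced-pos-onto F U (r k) (E∩U-nonempty k)
    ρ = λ k → proj₁ (hit k)
    ρ-inj : Injective _≡_ _≡_ ρ
    ρ-inj {k} {k′} eq = r-inj (trans (sym (proj₂ (hit k))) (trans (cong (pos eL) eq) (proj₂ (hit k′))))
    G = select L (image ρ)
    ∣G∣≡ : length G ≡ suc p
    ∣G∣≡ = trans (length-select L (image ρ)) (∣image∣≡ ρ ρ-inj)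
    eG = ⊑⇒embedding (select-⊑ L (image ρ))
    hitG = λ k → select-pos-onto L (image ρ) (ρ k) (∈image⁺ ρ k)
    σ = λ k → proj₁ (hitG k)
    σ-inj : Injective _≡_ _≡_ σ
    σ-inj {k} {k′} eq = ρ-inj (trans (sym (proj₂ (hitG k))) (trans (cong (pos eG) eq) (proj₂ (hitG k′))))
    Gσ≡ : ∀ k → lookup G (σ k) ≡ E k ∩ U
    Gσ≡ k = begin
      lookup G (σ k)                ≡⟨ lookup-pos eG (σ k) ⟩
      lookup L (pos eG (σ k))       ≡⟨ cong (lookup L) (proj₂ (hitG k)) ⟩
      lookup L (ρ k)                ≡⟨ lookup-pos eL (ρ k) ⟩
      lookup F (pos eL (ρ k)) ∩ U   ≡⟨ cong (λ i → lookup F i ∩ U) (proj₂ (hit k)) ⟩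
      E k ∩ U                       ∎
      where open ≡-Reasoning
    onto : ∀ v → v ∈ vertices G → ∃ λ j → c j ≡ v
    onto v v∈ = ∈U⇒ (vertices-induced⊆ F U (select-⊑ L (image ρ)) v∈)
    incidenceG : ∀ i j → Vec.lookup (lookup G (σ i)) (c j) ≡ Jinc i j
    incidenceG i j = trans (cong (λ S → Vec.lookup S (c j)) (Gσ≡ i)) (trans (lookup-∩ (E i) U (c j) (c∈U j)) (incidence i j))

  -- For S_k = T_k ∪ (U − ⋃ T), the edge E_k contains the k-th support set but misses T_k.
  cond-viii⇒JFree : Conditions.cond-viii p q F → JFree q F
  cond-viii⇒JFree viii s s<q J =
    core-avoids-TT (viii s s<q U U⊆V ∣U∣≡ T T-disjoint (λ i → ∣T∣≡t i , T⊆U i , ⊆-∈⇒Any (E∈F i) (U∖T⊆E i)))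
    where
    open JCopy 1≤p F s<q J
    TT = ⋃ (map T (allFin (suc p)))
    S = λ i → T i ∪ (U ─ TT)
    U∖T⊆E : ∀ i → U ─ T i ⊆ E i
    U∖T⊆E i y∈ = let (y∈U , y∉T) = x∈p─q⁻ U (T i) y∈ in ∈U∖T⇒∈E i y∈U y∉T
    S⊆E : ∀ i j → j ≢ i → S j ⊆ E i
    S⊆E i j j≢i = ∪-least (T⊆E j i (≢-sym j≢i)) λ y∈ →
      let (y∈U , y∉TT) = x∈p─q⁻ U TT y∈ in ∈U∖T⇒∈E i y∈U (λ y∈T → y∉TT (∈⋃-allFin⁺ T i y∈T))
    core-avoids-TT : ¬ Nonempty (core (HS∪ F S) ∩ TT)
    core-avoids-TT (x , x∈) with x∈p∩q⁻ _ TT x∈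
    ... | x∈core , x∈TT with ∈⋃-allFin⁻ T x∈TT
    ...   | i , x∈T with ∈image⁻ (tvertex i) x∈T
    ...     | a , refl = t∉E i a (core-HS∪⊆ S F (E∈F i) i (supportSet-least S i (S⊆E i)) x∈core)

  cond-ix⇒JFree : Conditions.cond-ix p q F → JFree q F
  cond-ix⇒JFree ix s s<q J = core-avoids-ext (ix A basis nontrivial starlike)
    where
    open JCopy 1≤p F s<q J
    A-inj : Injective _≡_ _≡_ A
    A-inj {i} A≡ = ∈A⇒≡ (subst (tvertex i a₀ ∈_) A≡ (t∈A i a₀))
    basis : IsBasis p q F A
    basis = A-inj , λ i → (λ x∈ → U⊆V (A⊆U i x∈)) , ∣A∣≡q i
    supportSet⊆E : ∀ k → supportSet A k ⊆ E k
    supportSet⊆E k = supportSet-least A k (λ j j≢k → A⊆E j k (≢-sym j≢k))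
    nontrivial : Nontrivial F A
    nontrivial k = ⊆-∈⇒Any (E∈F k) (supportSet⊆E k)
    Z⊆coreB : Z ⊆ coreB A
    Z⊆coreB x∈Z = ∈⋂-allFin⁺ A λ k → x∈p∪q⁺ (inj₂ x∈Z)
    starlike : Starlike A
    starlike v i j i≢j v∈i v∈j with x∈p∪q⁻ (T i) Z v∈i
    ... | inj₂ v∈Z = Z⊆coreB v∈Z
    ... | inj₁ v∈T with ∈image⁻ (tvertex i) v∈T
    ...   | a , refl = ⊥-elim (i≢j (∈A⇒≡ v∈j))
    core-avoids-ext : ¬ Nonempty (core (HS∪ F A) ∩ ext A)
    core-avoids-ext (x , x∈) with x∈p∩q⁻ _ (ext A) x∈
    ... | x∈core , x∈ext with x∈p─q⁻ _ (coreB A) x∈ext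
    ...   | x∈⋃ , x∉coreB with ∈⋃-allFin⁻ A x∈⋃
    ...     | i , x∈A with x∈p∪q⁻ (T i) Z x∈A
    ...       | inj₂ x∈Z = x∉coreB (Z⊆coreB x∈Z)
    ...       | inj₁ x∈T with ∈image⁻ (tvertex i) x∈T
    ...         | a , refl = t∉E i a (core-HS∪⊆ A F (E∈F i) i (supportSet⊆E i) x∈core)

-- Bases

module _ {p q : ℕ} (1≤p : 1 ≤ p) {n : ℕ} (F : Family n) where
  open Obstructions p 1≤p

  HS∪-covers : (S : Fin (suc p) → Subset n) → All (CoversAllBut S) (HS∪ F S)
  HS∪-covers S = All.map (λ { (k , ⊆E) → k , λ j j≢k {_} x∈ → ⊆E (∈supportSet⁺ S k j j≢k x∈) }) (All-HS∪ S F)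

  basis⇒∣coreB∣<q : ∀ {S} → IsBasis p q F S → ∣ coreB S ∣ < q
  basis⇒∣coreB∣<q {S} (S-inj , S-props) = subst (∣ coreB S ∣ <_) (proj₂ (S-props zero))
    (p⊂q⇒∣p∣<∣q∣ ((λ x∈ → ∈⋂-allFin⁻ S x∈ zero) , w , w∈S₀ , λ w∈coreB → w∉S₁ (∈⋂-allFin⁻ S w∈coreB (other zero))))
    where
    S₀⊈S₁ : ¬ (S zero ⊆ S (other zero))
    S₀⊈S₁ S₀⊆S₁ = other≢ zero (S-inj (sym (⊆∧∣∣≤⇒≡ S₀⊆S₁
      (ℕP.≤-reflexive (trans (proj₂ (S-props (other zero))) (sym (proj₂ (S-props zero))))))))
    gap = ⊈⇒∃∉ (S zero) (S (other zero)) S₀⊈S₁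
    w = proj₁ gap
    w∈S₀ = proj₁ (proj₂ gap)
    w∉S₁ = proj₂ (proj₂ gap)

  cond-x⇒cond-ix : Conditions.cond-x p q F → Conditions.cond-ix p q F
  cond-x⇒cond-ix x S basis nontrivial starlike with x S basis starlike
  ... | inj₂ meets  = meets
  ... | inj₁ HS∪≡[] = ⊥-elim (∈⇒≢[] (proj₂ (supported⇒∈HS∪ S F zero (nontrivial zero))) HS∪≡[])

  module _ (1≤q : 1 ≤ q) (hereditary : HereditaryHelly p q F) where

    -- Restricted to X, the edges covering all but one of the A_k form a (p,q)-intersecting
    -- subhypergraph.
    q≤∣X∩core∣ : (X : Subset n) → X ⊆ vertices F → (H : Family n) → H ⊑ F → (A : Fin (suc p) → Subset n) →
      (∀ k → q ≤ ∣ A k ∣) → (∀ k → A k ⊆ X) → All (CoversAllBut A) H → ∀ {E} → E ∈ₗ H → q ≤ ∣ X ∩ core H ∣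
    q≤∣X∩core∣ X X⊆V H τ A q≤∣A∣ A⊆X covers E∈H =
      ℕP.≤-trans (hereditary X X⊆V G (induced-mono X τ) (∈⇒≢[] (trace∈G E∈H)) intersecting) (p⊆q⇒∣p∣≤∣q∣ core-within)
      where
      G = induced H X
      trace∈G : ∀ {E} → E ∈ₗ H → E ∩ X ∈ₗ G
      trace∈G E∈ with All.lookup covers E∈
      ... | k , A⊆E with 1≤∣∣⇒Nonempty (A (other k)) (ℕP.≤-trans 1≤q (q≤∣A∣ (other k)))
      ...   | x , x∈A = ∈induced⁺ H X E∈ (x , x∈p∩q⁺ (A⊆E (other k) (other≢ k) x∈A , A⊆X (other k) x∈A))
      intersecting : Intersecting p q G
      intersecting = coversAllBut⇒intersecting A q≤∣A∣ G
        (All-induced H X (λ { (k , A⊆E) → k , λ j j≢k {_} x∈ → x∈p∩q⁺ (A⊆E j j≢k x∈ , A⊆X j x∈) }) covers)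
      core-within : core G ⊆ X ∩ core H
      core-within x∈ = x∈p∩q⁺ (proj₂ (x∈p∩q⁻ _ X (core⊆ (trace∈G E∈H) x∈)) ,
                               ∈⋂⁺ H (λ E∈ → proj₁ (x∈p∩q⁻ _ X (core⊆ (trace∈G E∈) x∈))))

    hereditaryHelly⇒cond-x : Conditions.cond-x p q F
    hereditaryHelly⇒cond-x S basis@(_ , S-props) _ =
      [ inj₂ , (λ avoids → inj₁ (∉⇒≡[] (HS∪ F S) (λ E∈ → ℕP.<⇒≱ (∣W∩core∣<q avoids) (q≤∣W∩core∣ E∈)))) ]′
        (toSum (nonempty? (core (HS∪ F S) ∩ ext S)))
      where
      W = ⋃ (map S (allFin (suc p)))
      q≤∣W∩core∣ : ∀ {E} → E ∈ₗ HS∪ F S → q ≤ ∣ W ∩ core (HS∪ F S) ∣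
      q≤∣W∩core∣ = q≤∣X∩core∣ W (λ x∈ → let (k , x∈S) = ∈⋃-allFin⁻ S x∈ in proj₁ (S-props k) x∈S)
        (HS∪ F S) (HS∪-⊑ S F) S (λ k → ℕP.≤-reflexive (sym (proj₂ (S-props k)))) (∈⋃-allFin⁺ S) (HS∪-covers S)
      ∣W∩core∣<q : ¬ Nonempty (core (HS∪ F S) ∩ ext S) → ∣ W ∩ core (HS∪ F S) ∣ < q
      ∣W∩core∣<q avoids = ℕP.≤-<-trans (p⊆q⇒∣p∣≤∣q∣ W∩core⊆coreB) (basis⇒∣coreB∣<q basis)
        where
        W∩core⊆coreB : W ∩ core (HS∪ F S) ⊆ coreB S
        W∩core⊆coreB {x} x∈ with x ∈? coreB S
        ... | yes x∈coreB = x∈coreB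
        ... | no  x∉coreB = let (x∈W , x∈core) = x∈p∩q⁻ W _ x∈ in
                            ⊥-elim (avoids (x , x∈p∩q⁺ (x∈core , x∈p∧x∉q⇒x∈p─q x∈W x∉coreB)))

    hereditaryHelly⇒cond-viii : Conditions.cond-viii p q F
    hereditaryHelly⇒cond-viii s s<q U U⊆V ∣U∣≡ T disjoint T-props =
      [ id , (λ avoids → ⊥-elim (ℕP.<⇒≱ (∣U∩core∣<q avoids) q≤∣U∩core∣)) ]′ (toSum (nonempty? (core (HS∪ F S) ∩ TT)))
      where
      t = q ∸ s
      TT = ⋃ (map T (allFin (suc p)))
      Z = U ─ TT
      S = λ i → T i ∪ Z
      T⊆U : ∀ i → T i ⊆ U
      T⊆U i = proj₁ (proj₂ (T-props i))
      TT⊆U : TT ⊆ U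
      TT⊆U x∈ = let (i , x∈T) = ∈⋃-allFin⁻ T x∈ in T⊆U i x∈T
      ∣Z∣≡s : ∣ Z ∣ ≡ s
      ∣Z∣≡s = ℕP.+-cancelʳ-≡ (suc p * t) ∣ Z ∣ s (begin
        ∣ Z ∣ + suc p * t   ≡⟨ cong (∣ Z ∣ +_) (∣⋃∣≡ T disjoint (λ i → proj₁ (T-props i))) ⟨
        ∣ Z ∣ + ∣ TT ∣      ≡⟨ ∣p─q∣+∣q∣≡∣p∣ U TT TT⊆U ⟩
        ∣ U ∣              ≡⟨ ∣U∣≡ ⟩
        suc p * t + s      ≡⟨ ℕP.+-comm (suc p * t) s ⟩
        s + suc p * t      ∎)
        where open ≡-Reasoning
      ∣S∣≡q : ∀ j → ∣ S j ∣ ≡ q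
      ∣S∣≡q j = begin
        ∣ T j ∪ Z ∣      ≡⟨ ∣p∪q∣≡∣p∣+∣q∣ (T j) Z T∩Z-empty ⟩
        ∣ T j ∣ + ∣ Z ∣   ≡⟨ cong₂ _+_ (proj₁ (T-props j)) ∣Z∣≡s ⟩
        t + s           ≡⟨ ℕP.m∸n+n≡m (ℕP.<⇒≤ s<q) ⟩
        q               ∎
        where
        open ≡-Reasoning
        T∩Z-empty : Empty (T j ∩ Z)
        T∩Z-empty (x , x∈) = let (x∈T , x∈Z) = x∈p∩q⁻ (T j) Z x∈ in proj₂ (x∈p─q⁻ U TT x∈Z) (∈⋃-allFin⁺ T j x∈T)
      S⊆U∖T₀ : ∀ j → j ≢ zero → S j ⊆ U ─ T zero
      S⊆U∖T₀ j j≢0 = ∪-least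
        (λ x∈T → x∈p∧x∉q⇒x∈p─q (T⊆U j x∈T) (λ x∈T₀ → disjoint j zero j≢0 (_ , x∈p∩q⁺ (x∈T , x∈T₀))))
        (λ x∈Z → let (x∈U , x∉TT) = x∈p─q⁻ U TT x∈Z in x∈p∧x∉q⇒x∈p─q x∈U (λ x∈T₀ → x∉TT (∈⋃-allFin⁺ T zero x∈T₀)))
      E₀∈HS∪ : ∃ λ E → E ∈ₗ HS∪ F S
      E₀∈HS∪ = supported⇒∈HS∪ S F zero
        (Any.map (λ ⊆E {_} x∈ → ⊆E (supportSet-least S zero S⊆U∖T₀ x∈)) (proj₂ (proj₂ (T-props zero))))
      q≤∣U∩core∣ : q ≤ ∣ U ∩ core (HS∪ F S) ∣
      q≤∣U∩core∣ = q≤∣X∩core∣ U U⊆V (HS∪ F S) (HS∪-⊑ S F) S (λ j → ℕP.≤-reflexive (sym (∣S∣≡q j))) (λ j → ∪-least (T⊆U j) (p─q⊆p U TT))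
                     (HS∪-covers S) (proj₂ E₀∈HS∪)
      ∣U∩core∣<q : ¬ Nonempty (core (HS∪ F S) ∩ TT) → ∣ U ∩ core (HS∪ F S) ∣ < q
      ∣U∩core∣<q avoids = ℕP.≤-<-trans (p⊆q⇒∣p∣≤∣q∣ U∩core⊆Z) (subst (_< q) (sym ∣Z∣≡s) s<q)
        where
        U∩core⊆Z : U ∩ core (HS∪ F S) ⊆ Z
        U∩core⊆Z {x} x∈ with x ∈? TT
        ... | yes x∈TT = ⊥-elim (avoids (x , x∈p∩q⁺ (proj₂ (x∈p∩q⁻ U _ x∈) , x∈TT)))
        ... | no  x∉TT = x∈p∧x∉q⇒x∈p─q (proj₁ (x∈p∩q⁻ U _ x∈)) x∉TT

module Characterisation {p q : ℕ} (1≤p : 1 ≤ p) (1≤q : 1 ≤ q) {n : ℕ} (F : Family n) where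
  open Obstructions p 1≤p
  open Conditions p q F

  private
    obstructionFree : JFree q F → ObstructionFree q F
    obstructionFree = JFree⇒obstructionFree {F = F} 1≤q

    JFree⇒i : JFree q F → cond-i
    JFree⇒i free = obstructionFree⇒hereditaryHelly {F = F} (obstructionFree free)

    JFree⇒iii : JFree q F → cond-iii
    JFree⇒iii free = obstructionFree⇒strongHelly {F = F} (obstructionFree free)

  i⇔JFree : cond-i ⇔ JFree q F
  i⇔JFree = mk⇔ (hereditaryHelly⇒JFree 1≤p F) JFree⇒i

  ii⇔JFree : cond-ii ⇔ JFree q F
  ii⇔JFree = mk⇔ (helly≥⇒JFree 1≤p F) (λ free → obstructionFree⇒Helly {F = F} (obstructionFree free))

  iii⇔JFree : cond-iii ⇔ JFree q F
  iii⇔JFree = mk⇔ (λ strong → partialStrongHelly⇒JFree 1≤p F (λ _ τ _ → strongHelly-⊑ strong τ)) JFree⇒iii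

  iv⇔JFree : cond-iv ⇔ JFree q F
  iv⇔JFree = mk⇔ (partialStrongHelly⇒JFree 1≤p F) (λ free _ τ _ → strongHelly-⊑ (JFree⇒iii free) τ)

  v⇔JFree : cond-v ⇔ JFree q F
  v⇔JFree = mk⇔ (ΦhereditaryHelly⇒JFree 1≤p F)
    (λ free → obstructionFree⇒hereditaryHelly {F = Φ q F} (obstructionFree free ∘ Φ-obstruction F))

  vii⇔JFree : cond-vii ⇔ JFree q F
  vii⇔JFree = mk⇔ (partialSubhypergraphs⇒JFree 1≤p F) (JFree⇒partialSubhypergraphs 1≤p F)

  viii⇔JFree : cond-viii ⇔ JFree q F
  viii⇔JFree = mk⇔ (cond-viii⇒JFree 1≤p F) (hereditaryHelly⇒cond-viii 1≤p F 1≤q ∘ JFree⇒i)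

  x⇔JFree : cond-x ⇔ JFree q F
  x⇔JFree = mk⇔ (cond-ix⇒JFree 1≤p F ∘ cond-x⇒cond-ix 1≤p F) (hereditaryHelly⇒cond-x 1≤p F 1≤q ∘ JFree⇒i)

  ix⇔JFree : cond-ix ⇔ JFree q F
  ix⇔JFree = mk⇔ (cond-ix⇒JFree 1≤p F) (cond-x⇒cond-ix 1≤p F ∘ Equivalence.from x⇔JFree)

theorem2p13 : (p q : ℕ) → 1 ≤ p → 1 ≤ q → (n : ℕ) → (F : Family n) → IsHypergraph F →
    let open Conditions p q F in
      (cond-i ⇔ cond-ii) × (cond-i ⇔ cond-iii) × (cond-i ⇔ cond-iv) ×
      (cond-i ⇔ cond-v) × (cond-i ⇔ cond-vi) × (cond-i ⇔ cond-vii) ×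
      (cond-i ⇔ cond-viii) × (cond-i ⇔ cond-ix) × (cond-i ⇔ cond-x)
theorem2p13 p q 1≤p 1≤q n F _ =
  via ii⇔JFree , via iii⇔JFree , via iv⇔JFree , via v⇔JFree , i⇔JFree , via vii⇔JFree ,
  via viii⇔JFree , via ix⇔JFree , via x⇔JFree
  where
  open Characterisation 1≤p 1≤q F
  via : ∀ {C : Set} → C ⇔ Obstructions.JFree p 1≤p q F → Conditions.cond-i p q F ⇔ C
  via C⇔JFree = ⇔.trans i⇔JFree (⇔.sym C⇔JFree)
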